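{- Let $s>7$ be a square-free integer with $7\nmid s$ and $s\equiv 3\pmod 4$, and let $K=\mathbb{Q}(\sqrt{7},\sqrt{s})$. Then $\mathcal{P}(\mathcal{O}_K)\geq 6$. In particular, the following element $\alpha\in\mathcal{O}_K$ has length $\ell(\alpha)=6$: if $s\geq 15$, $\alpha = 1^2+1^2+1^2+(1+\sqrt{7})^2+\left(\frac{\sqrt{7}+\sqrt{s}}{2}\right)^2+\left(1+\frac{\sqrt{7}+\sqrt{s}}{2}\right)^2$; and if $s=11$, $\alpha = 1^2+1^2+1^2+(2+\sqrt{7})^2+\left(\frac{\sqrt{7}+\sqrt{11}}{2}\right)^2+\left(1+\frac{\sqrt{7}+\sqrt{11}}{2}\right)^2$.
   Context: For a commutative ring $R$, the length $\ell(\alpha)$ of a sum of squares $\alpha$ is the minimal number of squares of elements of $R$ summing to $\alpha$, and the Pythagoras number $\mathcal{P}(R)$ is the supremum of lengths of all finite sums of squares in $R$. $\mathcal{O}_K$ is the ring of integers of $K$. -}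

module Defs where

open import Data.Nat as ℕ using (ℕ; _<_; _%_)
open import Data.Nat.Divisibility using (_∣_)
open import Data.Integer as ℤ using (ℤ; +_)
open import Data.Rational as ℚ using (ℚ; 0ℚ; 1ℚ; ½; _/_)
open import Data.List using (List; []; _∷_; length)
open import Data.List.Relation.Unary.All using (All)
open import Data.Product using (Σ; _×_; ∃-syntax)
open import Relation.Binary.PropositionalEquality using (_≡_)
open import Relation.Nullary using (¬_)

SquareFree : ℕ → Set
SquareFree n = ∀ d → d ℕ.* d ∣ n → d ≡ 1

-- The field K = ℚ(√7, √s), modelled concretely as ℚ-vectors over the
-- basis 1, √7, √s, √7·√s.  (For square-free s ≠ 7 this is a field of degree 4.)
record K (s : ℕ) : Set where
  constructor ⟨_,_,_,_⟩
  field
    c1 c7 cs c7s : ℚ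

module _ {s : ℕ} where
  private
    S : ℚ
    S = + s / 1
    q7 : ℚ
    q7 = + 7 / 1

  infixl 6 _⊕_
  infixl 7 _⊗_

  _⊕_ : K s → K s → K s
  ⟨ a , b , c , d ⟩ ⊕ ⟨ a' , b' , c' , d' ⟩ =
    ⟨ a ℚ.+ a' , b ℚ.+ b' , c ℚ.+ c' , d ℚ.+ d' ⟩

  -- multiplication using (√7)² = 7, (√s)² = s
  _⊗_ : K s → K s → K s
  ⟨ a , b , c , d ⟩ ⊗ ⟨ a' , b' , c' , d' ⟩ =
    ⟨ a ℚ.* a' ℚ.+ q7 ℚ.* b ℚ.* b' ℚ.+ S ℚ.* c ℚ.* c' ℚ.+ q7 ℚ.* S ℚ.* d ℚ.* d'
    , a ℚ.* b' ℚ.+ b ℚ.* a' ℚ.+ S ℚ.* (c ℚ.* d' ℚ.+ d ℚ.* c')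
    , a ℚ.* c' ℚ.+ c ℚ.* a' ℚ.+ q7 ℚ.* (b ℚ.* d' ℚ.+ d ℚ.* b')
    , a ℚ.* d' ℚ.+ d ℚ.* a' ℚ.+ b ℚ.* c' ℚ.+ c ℚ.* b' ⟩

  𝟘 𝟙 : K s
  𝟘 = ⟨ 0ℚ , 0ℚ , 0ℚ , 0ℚ ⟩
  𝟙 = ⟨ 1ℚ , 0ℚ , 0ℚ , 0ℚ ⟩

  ι : ℤ → K s
  ι z = ⟨ z / 1 , 0ℚ , 0ℚ , 0ℚ ⟩

  -- value at x of the monic integer polynomial
  -- c₀ + c₁ x + … + c_{n-1} x^{n-1} + x^n, where cs = c₀ ∷ … ∷ c_{n-1}
  evalMonic : List ℤ → K s → K s
  evalMonic []       x = 𝟙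
  evalMonic (c ∷ cs) x = ι c ⊕ x ⊗ evalMonic cs x

  -- membership in the ring of integers 𝒪_K: root of a monic integer polynomial
  IsAlgInt : K s → Set
  IsAlgInt x = ∃[ cs ] evalMonic cs x ≡ 𝟘

  sumSq : List (K s) → K s
  sumSq []       = 𝟘
  sumSq (x ∷ xs) = x ⊗ x ⊕ sumSq xs

  SumOfSquares : ℕ → K s → Set
  SumOfSquares n α =
    ∃[ xs ] (length xs ≡ n × All IsAlgInt xs × sumSq xs ≡ α)

  HasLength : K s → ℕ → Set
  HasLength α n = SumOfSquares n α × (∀ m → m < n → ¬ SumOfSquares m α)

  PythagorasAtLeast : ℕ → Set
  PythagorasAtLeast n =
    ∃[ α ] ∃[ k ] (SumOfSquares k α × (∀ m → m < n → ¬ SumOfSquares m α))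

√7 : {s : ℕ} → K s
√7 = ⟨ 0ℚ , 1ℚ , 0ℚ , 0ℚ ⟩

ω : {s : ℕ} → K s
ω = ⟨ 0ℚ , ½ , ½ , 0ℚ ⟩

sq : {s : ℕ} → K s → K s
sq x = x ⊗ x

α≥15 : (s : ℕ) → K s
α≥15 s = sq 𝟙 ⊕ sq 𝟙 ⊕ sq 𝟙 ⊕ sq (𝟙 ⊕ √7) ⊕ sq ω ⊕ sq (𝟙 ⊕ ω)

α11 : K 11
α11 = sq 𝟙 ⊕ sq 𝟙 ⊕ sq 𝟙 ⊕ sq (ι (+ 2) ⊕ √7) ⊕ sq ω ⊕ sq (𝟙 ⊕ ω)

{-# OPTIONS --safe #-}
module Submission where

-- Every algebraic integer of K = ℚ(√7, √s) is (A + B√7 + C√s + D√7s)/2 with A ≡ D and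
-- B ≡ C (mod 2): the powers of an algebraic integer have bounded denominators, hence so do all
-- elements of the ring generated by its conjugates; the traces and norms down to ℚ(√7), ℚ(√s)
-- and ℚ(√7s) lie in that ring, so they are integers, and ℤ[√m] is the ring of integers of ℚ(√m)
-- for squarefree m ≡ 3 (mod 4).
--
-- Writing α as a sum of at most five squares (padded with 0² to exactly five) then gives five
-- integer quadruples solving four equations, one for each coordinate of α. For s ≥ 15 parity and
-- the √s-coordinate force s·Σ(C² + 7D²) ≥ 2s, which bounds every quadruple independently of s;
-- for s = 11 the rational coordinate bounds them. A dynamic-programming enumeration of the
-- reachable coordinate sums then shows that none equals α. The six squares exhibited in the
-- statement are checked directly, their integrality by explicit monic polynomials.

open import Data.Nat as ℕ using (ℕ; zero; suc; s≤s; z≤n; _<_; _≤_; _∸_; _%_)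
import Data.Nat.Properties as ℕP
open import Data.Nat.DivMod using (m≡m%n+[m/n]*n; m%n<n)
open import Data.Nat.Divisibility as ℕD using (_∣_; divides)
open import Data.Nat.Coprimality as Coprimality using (Coprime)
open import Data.Nat.Primality using (prime?; euclidsLemma; prime⇒irreducible; prime[2])
open import Data.Nat.ListAction using (sum)
import Data.Nat.Solver
open import Data.Integer as ℤ using (ℤ; +_; -[1+_])
import Data.Integer.Properties as ℤP
open import Data.Integer.Divisibility.Signed as ℤD using (divides; ∣ᵤ⇒∣; ∣⇒∣ᵤ)
import Data.Integer.Solver
open import Data.Rational as ℚ using (ℚ; _/_; 0ℚ; 1ℚ; ½; mkℚ; ↥_; ↧_; ↧ₙ_; toℚᵘ)
import Data.Rational.Properties as ℚP
open import Data.Rational.Unnormalised as ℚᵘ using (mkℚᵘ; *≡*)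
import Data.Rational.Unnormalised.Properties as ℚᵘP
import Data.Rational.Solver
open import Data.Bool using (Bool; true; false; T; not; if_then_else_)
open import Data.Bool.ListAction using (and)
open import Data.Fin using (Fin; toℕ; fromℕ<; #_)
import Data.Fin.Properties as FinP
open import Data.Vec as Vec using (Vec; []; _∷_)
import Data.Vec.Properties as VecP
open import Data.List using (List; []; _∷_; length; foldr; map; filter; cartesianProduct; applyUpTo; _++_; replicate)
import Data.List.Properties as ListP
open import Data.List.Membership.Propositional using (_∈_)
open import Data.List.Membership.Propositional.Properties using (∈-map⁺; ∈-filter⁺; ∈-++⁺ˡ; ∈-++⁺ʳ; ∈-applyUpTo⁺; ∈-cartesianProduct⁺)
open import Data.List.Relation.Unary.All as All using (All; []; _∷_)
import Data.List.Relation.Unary.All.Properties as AllP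
open import Data.List.Relation.Unary.Any using (here; there)
open import Data.Product using (Σ; _×_; _,_; proj₁; proj₂)
open import Data.Sum using (_⊎_; inj₁; inj₂)
open import Data.Empty using (⊥; ⊥-elim)
open import Data.Unit using (⊤; tt)
open import Function using (_∘_)
open import Relation.Binary.PropositionalEquality
open import Relation.Nullary using (¬_; Dec; yes; no; does)
open import Relation.Nullary.Decidable using (_×-dec_; _⊎-dec_; _→-dec_; from-yes)
open import Relation.Unary using (Decidable)
open import Defs

private
  module ℕS = Data.Nat.Solver.+-*-Solver
  module ℤS = Data.Integer.Solver.+-*-Solver
  module ℚS = Data.Rational.Solver.+-*-Solver

open Data.Rational.Solver.+-*-Solver using (Polynomial; prove; con; var; _:+_; _:*_; :-_; _:-_; ⟦_⟧; ⟦_⟧↓)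

fromℤ : ℤ → ℚ
fromℤ z = z / 1

Integral : ℚ → Set
Integral q = Σ ℤ λ z → q ≡ fromℤ z

private
  fromℤ-≃ : ∀ z → toℚᵘ (fromℤ z) ℚᵘ.≃ mkℚᵘ z 0
  fromℤ-≃ z = ℚP.toℚᵘ-fromℚᵘ (mkℚᵘ z 0)

  infixr 5 _⊚_
  _⊚_ : ∀ {p q r} → p ℚᵘ.≃ q → q ℚᵘ.≃ r → p ℚᵘ.≃ r
  _⊚_ = ℚᵘP.≃-trans

fromℤ-+ : ∀ a b → fromℤ (a ℤ.+ b) ≡ fromℤ a ℚ.+ fromℤ b
fromℤ-+ a b = ℚP.toℚᵘ-injective
  (fromℤ-≃ (a ℤ.+ b) ⊚ *≡* (ℤS.solve 2 (λ a b → (a ℤS.:+ b) ℤS.:* ℤS.con (+ 1) ℤS.:= (a ℤS.:* ℤS.con (+ 1) ℤS.:+ b ℤS.:* ℤS.con (+ 1)) ℤS.:* ℤS.con (+ 1)) refl a b)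
   ⊚ ℚᵘP.+-cong (ℚᵘP.≃-sym (fromℤ-≃ a)) (ℚᵘP.≃-sym (fromℤ-≃ b)) ⊚ ℚᵘP.≃-sym (ℚP.toℚᵘ-homo-+ (fromℤ a) (fromℤ b)))

fromℤ-* : ∀ a b → fromℤ (a ℤ.* b) ≡ fromℤ a ℚ.* fromℤ b
fromℤ-* a b = ℚP.toℚᵘ-injective
  (fromℤ-≃ (a ℤ.* b) ⊚ *≡* refl ⊚ ℚᵘP.*-cong (ℚᵘP.≃-sym (fromℤ-≃ a)) (ℚᵘP.≃-sym (fromℤ-≃ b)) ⊚ ℚᵘP.≃-sym (ℚP.toℚᵘ-homo-* (fromℤ a) (fromℤ b)))

fromℤ-neg : ∀ a → fromℤ (ℤ.- a) ≡ ℚ.- fromℤ a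
fromℤ-neg a = ℚP.toℚᵘ-injective
  (fromℤ-≃ (ℤ.- a) ⊚ *≡* refl ⊚ ℚᵘP.-‿cong (ℚᵘP.≃-sym (fromℤ-≃ a)) ⊚ ℚᵘP.≃-sym (ℚP.toℚᵘ-homo‿- (fromℤ a)))

fromℤ-injective : ∀ {a b} → fromℤ a ≡ fromℤ b → a ≡ b
fromℤ-injective {a} {b} e with ℚᵘP.≃-sym (fromℤ-≃ a) ⊚ ℚP.toℚᵘ-cong e ⊚ fromℤ-≃ b
... | *≡* eq = trans (sym (ℤP.*-identityʳ a)) (trans eq (ℤP.*-identityʳ b))

*-↧≡↥ : ∀ q → q ℚ.* fromℤ (↧ q) ≡ fromℤ (↥ q)
*-↧≡↥ q@record{} = ℚP.toℚᵘ-injective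
  (ℚP.toℚᵘ-homo-* q (fromℤ (↧ q)) ⊚ ℚᵘP.*-cong (ℚᵘP.≃-refl {toℚᵘ q}) (fromℤ-≃ (↧ q))
   ⊚ *≡* (ℤS.solve 2 (λ a b → (a ℤS.:* b) ℤS.:* ℤS.con (+ 1) ℤS.:= a ℤS.:* (b ℤS.:* ℤS.con (+ 1))) refl (↥ q) (↧ q))
   ⊚ ℚᵘP.≃-sym (fromℤ-≃ (↥ q)))

Integral-+ : ∀ {p q} → Integral p → Integral q → Integral (p ℚ.+ q)
Integral-+ (a , refl) (b , refl) = a ℤ.+ b , sym (fromℤ-+ a b)

Integral-* : ∀ {p q} → Integral p → Integral q → Integral (p ℚ.* q)
Integral-* (a , refl) (b , refl) = a ℤ.* b , sym (fromℤ-* a b)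

Integral-neg : ∀ {p} → Integral p → Integral (ℚ.- p)
Integral-neg (a , refl) = ℤ.- a , sym (fromℤ-neg a)

-- Integer polynomial expressions, so that an identity between integers can be read off from the
-- corresponding identity between their images in ℚ (which the ℚ ring solver can prove).
infixl 6 _⊞_
infixl 7 _⊠_

data IntExpr (n : ℕ) : Set where
  evar : Fin n → IntExpr n
  econ : ℤ → IntExpr n
  _⊞_ _⊠_ : IntExpr n → IntExpr n → IntExpr n
  ⊟_ : IntExpr n → IntExpr n

⟦_⟧ℤ : ∀ {n} → IntExpr n → Vec ℤ n → ℤ
⟦ evar i ⟧ℤ ρ = Vec.lookup ρ i
⟦ econ z ⟧ℤ ρ = z
⟦ e ⊞ f ⟧ℤ ρ = ⟦ e ⟧ℤ ρ ℤ.+ ⟦ f ⟧ℤ ρ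
⟦ e ⊠ f ⟧ℤ ρ = ⟦ e ⟧ℤ ρ ℤ.* ⟦ f ⟧ℤ ρ
⟦ ⊟ e ⟧ℤ ρ = ℤ.- ⟦ e ⟧ℤ ρ

⟦_⟧ℚ : ∀ {n} → IntExpr n → Vec ℚ n → ℚ
⟦ evar i ⟧ℚ ρ = Vec.lookup ρ i
⟦ econ z ⟧ℚ ρ = fromℤ z
⟦ e ⊞ f ⟧ℚ ρ = ⟦ e ⟧ℚ ρ ℚ.+ ⟦ f ⟧ℚ ρ
⟦ e ⊠ f ⟧ℚ ρ = ⟦ e ⟧ℚ ρ ℚ.* ⟦ f ⟧ℚ ρ
⟦ ⊟ e ⟧ℚ ρ = ℚ.- ⟦ e ⟧ℚ ρ

fromℤ-⟦⟧ : ∀ {n} (e : IntExpr n) (ρ : Vec ℤ n) → fromℤ (⟦ e ⟧ℤ ρ) ≡ ⟦ e ⟧ℚ (Vec.map fromℤ ρ)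
fromℤ-⟦⟧ (evar i) ρ = sym (VecP.lookup-map i fromℤ ρ)
fromℤ-⟦⟧ (econ z) ρ = refl
fromℤ-⟦⟧ (e ⊞ f) ρ = trans (fromℤ-+ (⟦ e ⟧ℤ ρ) (⟦ f ⟧ℤ ρ)) (cong₂ ℚ._+_ (fromℤ-⟦⟧ e ρ) (fromℤ-⟦⟧ f ρ))
fromℤ-⟦⟧ (e ⊠ f) ρ = trans (fromℤ-* (⟦ e ⟧ℤ ρ) (⟦ f ⟧ℤ ρ)) (cong₂ ℚ._*_ (fromℤ-⟦⟧ e ρ) (fromℤ-⟦⟧ f ρ))
fromℤ-⟦⟧ (⊟ e) ρ = trans (fromℤ-neg (⟦ e ⟧ℤ ρ)) (cong ℚ.-_ (fromℤ-⟦⟧ e ρ))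

infixr 8 _^ℚ_

_^ℚ_ : ℚ → ℕ → ℚ
q ^ℚ zero = 1ℚ
q ^ℚ suc k = q ℚ.* q ^ℚ k

^ℚ-distribʳ-* : ∀ a b k → (a ℚ.* b) ^ℚ k ≡ a ^ℚ k ℚ.* b ^ℚ k
^ℚ-distribʳ-* a b zero = refl
^ℚ-distribʳ-* a b (suc k) = trans (cong ((a ℚ.* b) ℚ.*_) (^ℚ-distribʳ-* a b k))
  (ℚS.solve 4 (λ a b x y → (a ℚS.:* b) ℚS.:* (x ℚS.:* y) ℚS.:= (a ℚS.:* x) ℚS.:* (b ℚS.:* y)) refl a b (a ^ℚ k) (b ^ℚ k))

fromℤ-^ : ∀ z k → fromℤ (z ℤ.^ k) ≡ fromℤ z ^ℚ k
fromℤ-^ z zero = refl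
fromℤ-^ z (suc k) = trans (fromℤ-* z (z ℤ.^ k)) (cong (fromℤ z ℚ.*_) (fromℤ-^ z k))

∣i^n∣≡∣i∣^n : ∀ i n → ℤ.∣ i ℤ.^ n ∣ ≡ ℤ.∣ i ∣ ℕ.^ n
∣i^n∣≡∣i∣^n i zero = refl
∣i^n∣≡∣i∣^n i (suc n) = trans (ℤP.abs-* i (i ℤ.^ n)) (cong (ℤ.∣ i ∣ ℕ.*_) (∣i^n∣≡∣i∣^n i n))

coprime-*ˡ : ∀ {m n o} → Coprime m o → Coprime n o → Coprime (m ℕ.* n) o
coprime-*ˡ {m} {n} {o} m⊥o n⊥o {i} (i∣mn , i∣o) = n⊥o (Coprimality.coprime-divisor i⊥m i∣mn , i∣o)
  where
  i⊥m : Coprime i m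
  i⊥m (j∣i , j∣m) = m⊥o (j∣m , ℕD.∣-trans j∣i i∣o)

coprime-^ˡ : ∀ {m o} k → Coprime m o → Coprime (m ℕ.^ k) o
coprime-^ˡ zero _ (i∣1 , _) = ℕD.∣1⇒≡1 i∣1
coprime-^ˡ (suc k) m⊥o = coprime-*ˡ m⊥o (coprime-^ˡ k m⊥o)

-- Since numerator and denominator of q are coprime, M qᵏ ∈ ℤ forces (denominator of q)ᵏ ∣ M.
↧^∣ : ∀ q (M : ℕ) k → Integral (fromℤ (+ M) ℚ.* q ^ℚ k) → ↧ₙ q ℕ.^ k ∣ M
↧^∣ q@(mkℚ n d-1 n⊥d) M k (z , e) = Coprimality.coprime-divisor d^k⊥n^k d^k∣n^kM
  where
  d = suc d-1
  d^k⊥n^k : Coprime (d ℕ.^ k) (ℤ.∣ n ∣ ℕ.^ k)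
  d^k⊥n^k = coprime-^ˡ k (Coprimality.sym (coprime-^ˡ k (Coprimality.recompute n⊥d)))
  Mn^k≡zd^k : + M ℤ.* n ℤ.^ k ≡ z ℤ.* (+ d) ℤ.^ k
  Mn^k≡zd^k = fromℤ-injective (begin
     fromℤ (+ M ℤ.* n ℤ.^ k)                            ≡⟨ fromℤ-* (+ M) (n ℤ.^ k) ⟩
     fromℤ (+ M) ℚ.* fromℤ (n ℤ.^ k)                    ≡⟨ cong (fromℤ (+ M) ℚ.*_) (fromℤ-^ n k) ⟩
     fromℤ (+ M) ℚ.* fromℤ n ^ℚ k                       ≡⟨ cong (λ t → fromℤ (+ M) ℚ.* t ^ℚ k) (*-↧≡↥ q) ⟨
     fromℤ (+ M) ℚ.* (q ℚ.* fromℤ (+ d)) ^ℚ k           ≡⟨ cong (fromℤ (+ M) ℚ.*_) (^ℚ-distribʳ-* q (fromℤ (+ d)) k) ⟩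
     fromℤ (+ M) ℚ.* (q ^ℚ k ℚ.* fromℤ (+ d) ^ℚ k)      ≡⟨ ℚP.*-assoc (fromℤ (+ M)) (q ^ℚ k) _ ⟨
     (fromℤ (+ M) ℚ.* q ^ℚ k) ℚ.* fromℤ (+ d) ^ℚ k      ≡⟨ cong₂ ℚ._*_ e (sym (fromℤ-^ (+ d) k)) ⟩
     fromℤ z ℚ.* fromℤ ((+ d) ℤ.^ k)                    ≡⟨ fromℤ-* z _ ⟨
     fromℤ (z ℤ.* (+ d) ℤ.^ k)                          ∎)
    where open ≡-Reasoning
  d^k∣n^kM : d ℕ.^ k ∣ ℤ.∣ n ∣ ℕ.^ k ℕ.* M
  d^k∣n^kM = divides ℤ.∣ z ∣ (begin
     ℤ.∣ n ∣ ℕ.^ k ℕ.* M            ≡⟨ ℕP.*-comm (ℤ.∣ n ∣ ℕ.^ k) M ⟩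
     M ℕ.* ℤ.∣ n ∣ ℕ.^ k            ≡⟨ cong (M ℕ.*_) (∣i^n∣≡∣i∣^n n k) ⟨
     ℤ.∣ + M ∣ ℕ.* ℤ.∣ n ℤ.^ k ∣    ≡⟨ ℤP.abs-* (+ M) (n ℤ.^ k) ⟨
     ℤ.∣ + M ℤ.* n ℤ.^ k ∣          ≡⟨ cong ℤ.∣_∣ Mn^k≡zd^k ⟩
     ℤ.∣ z ℤ.* (+ d) ℤ.^ k ∣        ≡⟨ ℤP.abs-* z _ ⟩
     ℤ.∣ z ∣ ℕ.* ℤ.∣ (+ d) ℤ.^ k ∣  ≡⟨ cong (ℤ.∣ z ∣ ℕ.*_) (∣i^n∣≡∣i∣^n (+ d) k) ⟩
     ℤ.∣ z ∣ ℕ.* d ℕ.^ k            ∎)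
    where open ≡-Reasoning

multiple-of-↧-Integral : ∀ M q → Integral (fromℤ (+ (M ℕ.* ↧ₙ q)) ℚ.* q)
multiple-of-↧-Integral M q = + M ℤ.* ↥ q , eq
  where
  eq : fromℤ (+ (M ℕ.* ↧ₙ q)) ℚ.* q ≡ fromℤ (+ M ℤ.* ↥ q)
  eq = begin
    fromℤ (+ (M ℕ.* ↧ₙ q)) ℚ.* q          ≡⟨ cong (λ t → fromℤ t ℚ.* q) (ℤP.pos-* M (↧ₙ q)) ⟩
    fromℤ (+ M ℤ.* ↧ q) ℚ.* q             ≡⟨ cong (ℚ._* q) (fromℤ-* (+ M) (↧ q)) ⟩
    (fromℤ (+ M) ℚ.* fromℤ (↧ q)) ℚ.* q   ≡⟨ ℚS.solve 3 (λ a b c → (a ℚS.:* b) ℚS.:* c ℚS.:= a ℚS.:* (c ℚS.:* b)) refl (fromℤ (+ M)) (fromℤ (↧ q)) q ⟩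
    fromℤ (+ M) ℚ.* (q ℚ.* fromℤ (↧ q))   ≡⟨ cong (fromℤ (+ M) ℚ.*_) (*-↧≡↥ q) ⟩
    fromℤ (+ M) ℚ.* fromℤ (↥ q)           ≡⟨ fromℤ-* (+ M) (↥ q) ⟨
    fromℤ (+ M ℤ.* ↥ q)                   ∎
    where open ≡-Reasoning

↧≡1⇒Integral : ∀ q → ↧ₙ q ≡ 1 → Integral q
↧≡1⇒Integral q@(mkℚ n zero _) refl = n , trans (sym (ℚP.*-identityʳ q)) (*-↧≡↥ q)

n<2^n : ∀ n → n ℕ.< 2 ℕ.^ n
n<2^n zero = ℕ.s≤s ℕ.z≤n
n<2^n (suc n) = ℕP.+-mono-<-≤ (ℕP.m^n>0 2 n) (ℕP.≤-trans (n<2^n n) (ℕP.m≤m+n _ 0))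

-- A denominator d ≥ 2 would give dᴸ⁺¹ ∣ L + 1, impossible as L + 1 < 2ᴸ⁺¹.
bounded-powers⇒Integral : ∀ q L → (∀ k → Integral (fromℤ (+ suc L) ℚ.* q ^ℚ k)) → Integral q
bounded-powers⇒Integral q@(mkℚ _ zero _) L _ = ↧≡1⇒Integral q refl
bounded-powers⇒Integral q@(mkℚ _ (suc _) _) L h = ⊥-elim (ℕP.<⇒≱ (n<2^n (suc L))
  (ℕP.≤-trans (ℕP.^-monoˡ-≤ (suc L) (ℕ.s≤s (ℕ.s≤s ℕ.z≤n))) (ℕD.∣⇒≤ (↧^∣ q (suc L) (suc L) (h (suc L))))))

squarefree-multiple⇒Integral : ∀ m → SquareFree m → ∀ q → Integral (fromℤ (+ m) ℚ.* (q ℚ.* q)) → Integral q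
squarefree-multiple⇒Integral m sf q (z , e) = ↧≡1⇒Integral q (sf (↧ₙ q) (subst (_∣ m) (cong (↧ₙ q ℕ.*_) (ℕP.*-identityʳ (↧ₙ q)))
  (↧^∣ q m 2 (z , trans (cong (λ t → fromℤ (+ m) ℚ.* (q ℚ.* t)) (ℚP.*-identityʳ q)) e))))

i*i≡+∣i∣*∣i∣ : ∀ i → i ℤ.* i ≡ + (ℤ.∣ i ∣ ℕ.* ℤ.∣ i ∣)
i*i≡+∣i∣*∣i∣ (+ n) = sym (ℤP.pos-* n n)
i*i≡+∣i∣*∣i∣ -[1+ n ] = refl

2∣i*i⇒2∣i : ∀ i → + 2 ℤD.∣ i ℤ.* i → + 2 ℤD.∣ i
2∣i*i⇒2∣i i 2∣i² with euclidsLemma ℤ.∣ i ∣ ℤ.∣ i ∣ prime[2] (subst (2 ∣_) (ℤP.abs-* i i) (∣⇒∣ᵤ 2∣i²))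
... | inj₁ 2∣∣i∣ = ∣ᵤ⇒∣ 2∣∣i∣
... | inj₂ 2∣∣i∣ = ∣ᵤ⇒∣ 2∣∣i∣

-- Squares are 0 or 1 modulo 4.
4∣m²+n²⇒2∣m×2∣n : ∀ m n → 4 ∣ m ℕ.* m ℕ.+ n ℕ.* n → 2 ∣ m × 2 ∣ n
4∣m²+n²⇒2∣m×2∣n m n 4∣m²+n² = even m (proj₁ residues≡0) , even n (proj₂ residues≡0)
  where
  even : ∀ x → x % 2 ≡ 0 → 2 ∣ x
  even x e = divides (x ℕ./ 2) (trans (m≡m%n+[m/n]*n x 2) (cong (ℕ._+ (x ℕ./ 2) ℕ.* 2) e))
  residues : ∀ r t → r ℕ.< 2 → t ℕ.< 2 → 4 ∣ r ℕ.* r ℕ.+ t ℕ.* t → r ≡ 0 × t ≡ 0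
  residues 0 0 _ _ _ = refl , refl
  residues 0 1 _ _ 4∣1 with s≤s () ← ℕD.∣⇒≤ 4∣1
  residues 1 0 _ _ 4∣1 with s≤s () ← ℕD.∣⇒≤ 4∣1
  residues 1 1 _ _ 4∣2 with s≤s (s≤s ()) ← ℕD.∣⇒≤ 4∣2
  residues (suc (suc _)) _ (s≤s (s≤s ())) _ _
  residues _ (suc (suc _)) _ (s≤s (s≤s ())) _
  r = m % 2
  t = n % 2
  k = m ℕ./ 2 ℕ.* r ℕ.+ m ℕ./ 2 ℕ.* (m ℕ./ 2) ℕ.+ n ℕ./ 2 ℕ.* t ℕ.+ n ℕ./ 2 ℕ.* (n ℕ./ 2)
  expand : m ℕ.* m ℕ.+ n ℕ.* n ≡ 4 ℕ.* k ℕ.+ (r ℕ.* r ℕ.+ t ℕ.* t)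
  expand = trans (cong₂ (λ x y → x ℕ.* x ℕ.+ y ℕ.* y) (m≡m%n+[m/n]*n m 2) (m≡m%n+[m/n]*n n 2))
    (ℕS.solve 4 (λ r u t v → (r ℕS.:+ u ℕS.:* ℕS.con 2) ℕS.:* (r ℕS.:+ u ℕS.:* ℕS.con 2) ℕS.:+ (t ℕS.:+ v ℕS.:* ℕS.con 2) ℕS.:* (t ℕS.:+ v ℕS.:* ℕS.con 2)
        ℕS.:= ℕS.con 4 ℕS.:* (u ℕS.:* r ℕS.:+ u ℕS.:* u ℕS.:+ v ℕS.:* t ℕS.:+ v ℕS.:* v) ℕS.:+ (r ℕS.:* r ℕS.:+ t ℕS.:* t)) refl r (m ℕ./ 2) t (n ℕ./ 2))
  residues≡0 : r ≡ 0 × t ≡ 0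
  residues≡0 = residues r t (m%n<n m 2) (m%n<n n 2) (ℕD.∣m+n∣m⇒∣n (subst (4 ∣_) expand 4∣m²+n²) (ℕD.m∣m*n k))

4∣i²+j²⇒2∣i×2∣j : ∀ i j → + 4 ℤD.∣ i ℤ.* i ℤ.+ j ℤ.* j → + 2 ℤD.∣ i × + 2 ℤD.∣ j
4∣i²+j²⇒2∣i×2∣j i j 4∣i²+j² with 4∣m²+n²⇒2∣m×2∣n ℤ.∣ i ∣ ℤ.∣ j ∣
  (subst (4 ∣_) (cong ℤ.∣_∣ (trans (cong₂ ℤ._+_ (i*i≡+∣i∣*∣i∣ i) (i*i≡+∣i∣*∣i∣ j)) (sym (ℤP.pos-+ (ℤ.∣ i ∣ ℕ.* ℤ.∣ i ∣) (ℤ.∣ j ∣ ℕ.* ℤ.∣ j ∣))))) (∣⇒∣ᵤ 4∣i²+j²))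
... | 2∣∣i∣ , 2∣∣j∣ = ∣ᵤ⇒∣ 2∣∣i∣ , ∣ᵤ⇒∣ 2∣∣j∣

-- (X + Y)² ≡ X² + Y² ≡ p X² − q Y² modulo 2 when p and q are odd.
odd-combination⇒2∣+ : ∀ p q X Y → + 2 ℤD.∣ p ℤ.- + 1 → + 2 ℤD.∣ q ℤ.- + 1 →
  + 2 ℤD.∣ p ℤ.* (X ℤ.* X) ℤ.- q ℤ.* (Y ℤ.* Y) → + 2 ℤD.∣ X ℤ.+ Y
odd-combination⇒2∣+ p q X Y 2∣p-1 2∣q-1 2∣comb = 2∣i*i⇒2∣i (X ℤ.+ Y) (subst (+ 2 ℤD.∣_) (sym expand)
  (ℤD.∣m∣n⇒∣m+n (ℤD.∣m∣n⇒∣m-n 2∣comb (ℤD.∣m⇒∣m*n (X ℤ.* X) 2∣p-1))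
                (ℤD.∣m∣n⇒∣m+n (ℤD.∣m⇒∣m*n (Y ℤ.* Y) 2∣q-1) (ℤD.∣m⇒∣m*n (Y ℤ.* Y ℤ.+ X ℤ.* Y) ℤD.∣-refl))))
  where
  expand : (X ℤ.+ Y) ℤ.* (X ℤ.+ Y) ≡
    (p ℤ.* (X ℤ.* X) ℤ.- q ℤ.* (Y ℤ.* Y) ℤ.- (p ℤ.- + 1) ℤ.* (X ℤ.* X)) ℤ.+ ((q ℤ.- + 1) ℤ.* (Y ℤ.* Y) ℤ.+ + 2 ℤ.* (Y ℤ.* Y ℤ.+ X ℤ.* Y))
  expand = ℤS.solve 4 (λ p q X Y → (X ℤS.:+ Y) ℤS.:* (X ℤS.:+ Y) ℤS.:=
      (p ℤS.:* (X ℤS.:* X) ℤS.:- q ℤS.:* (Y ℤS.:* Y) ℤS.:- (p ℤS.:- ℤS.con (+ 1)) ℤS.:* (X ℤS.:* X))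
      ℤS.:+ ((q ℤS.:- ℤS.con (+ 1)) ℤS.:* (Y ℤS.:* Y) ℤS.:+ ℤS.con (+ 2) ℤS.:* (Y ℤS.:* Y ℤS.:+ X ℤS.:* Y))) refl p q X Y

half-Integral : ∀ q {G} → fromℤ (+ 2) ℚ.* q ≡ fromℤ G → + 2 ℤD.∣ G → Integral q
half-Integral q (2q≡G) (divides k refl) = k , (begin
  q                                 ≡⟨ ℚS.solve 1 (λ q → q ℚS.:= ℚS.con ½ ℚS.:* (ℚS.con (fromℤ (+ 2)) ℚS.:* q)) refl q ⟩
  ½ ℚ.* (fromℤ (+ 2) ℚ.* q)          ≡⟨ cong (½ ℚ.*_) 2q≡G ⟩
  ½ ℚ.* fromℤ (k ℤ.* + 2)            ≡⟨ cong (½ ℚ.*_) (fromℤ-* k (+ 2)) ⟩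
  ½ ℚ.* (fromℤ k ℚ.* fromℤ (+ 2))    ≡⟨ ℚS.solve 1 (λ k → ℚS.con ½ ℚS.:* (k ℚS.:* ℚS.con (fromℤ (+ 2))) ℚS.:= k) refl (fromℤ k) ⟩
  fromℤ k                           ∎)
  where open ≡-Reasoning

-- The ring of integers of ℚ(√m) is ℤ[√m] when m ≡ 3 (mod 4): if g + h√m has integral trace 2g and
-- norm g² − m h², then m (2h)² = (2g)² − 4 (g² − m h²) is integral, hence so is 2h as m is
-- squarefree, and (2g)² + (2h)² ≡ (2g)² − m (2h)² ≡ 0 (mod 4) makes 2g and 2h even.
trace-norm-integral⇒integral : ∀ m → m % 4 ≡ 3 → SquareFree m → ∀ g h →
  Integral (fromℤ (+ 2) ℚ.* g) → Integral (g ℚ.* g ℚ.- fromℤ (+ m) ℚ.* (h ℚ.* h)) → Integral g × Integral h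
trace-norm-integral⇒integral m m%4≡3 sf g h (G , 2g≡G) (N , norm≡N) =
  half-Integral g 2g≡G (proj₁ 2∣G×2∣H) , half-Integral h 2h≡H (proj₂ 2∣G×2∣H)
  where
  m[2h]²-integral : Integral (fromℤ (+ m) ℚ.* ((fromℤ (+ 2) ℚ.* h) ℚ.* (fromℤ (+ 2) ℚ.* h)))
  m[2h]²-integral = G ℤ.* G ℤ.- + 4 ℤ.* N , (begin
     fromℤ (+ m) ℚ.* ((fromℤ (+ 2) ℚ.* h) ℚ.* (fromℤ (+ 2) ℚ.* h))
       ≡⟨ ℚS.solve 3 (λ g h M → M ℚS.:* ((ℚS.con (fromℤ (+ 2)) ℚS.:* h) ℚS.:* (ℚS.con (fromℤ (+ 2)) ℚS.:* h))
              ℚS.:= (ℚS.con (fromℤ (+ 2)) ℚS.:* g) ℚS.:* (ℚS.con (fromℤ (+ 2)) ℚS.:* g) ℚS.:- ℚS.con (fromℤ (+ 4)) ℚS.:* (g ℚS.:* g ℚS.:- M ℚS.:* (h ℚS.:* h))) refl g h (fromℤ (+ m)) ⟩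
     (fromℤ (+ 2) ℚ.* g) ℚ.* (fromℤ (+ 2) ℚ.* g) ℚ.- fromℤ (+ 4) ℚ.* (g ℚ.* g ℚ.- fromℤ (+ m) ℚ.* (h ℚ.* h))
       ≡⟨ cong₂ (λ x y → x ℚ.* x ℚ.- fromℤ (+ 4) ℚ.* y) 2g≡G norm≡N ⟩
     fromℤ G ℚ.* fromℤ G ℚ.- fromℤ (+ 4) ℚ.* fromℤ N
       ≡⟨ fromℤ-⟦⟧ (evar (# 0) ⊠ evar (# 0) ⊞ ⊟ (econ (+ 4) ⊠ evar (# 1))) (G ∷ N ∷ []) ⟨
     fromℤ (G ℤ.* G ℤ.- + 4 ℤ.* N) ∎)
    where open ≡-Reasoning
  H : ℤ
  H = proj₁ (squarefree-multiple⇒Integral m sf (fromℤ (+ 2) ℚ.* h) m[2h]²-integral)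
  2h≡H : fromℤ (+ 2) ℚ.* h ≡ fromℤ H
  2h≡H = proj₂ (squarefree-multiple⇒Integral m sf (fromℤ (+ 2) ℚ.* h) m[2h]²-integral)
  G²-mH²≡4N : G ℤ.* G ℤ.- + m ℤ.* (H ℤ.* H) ≡ + 4 ℤ.* N
  G²-mH²≡4N = fromℤ-injective (begin
     fromℤ (G ℤ.* G ℤ.- + m ℤ.* (H ℤ.* H))
       ≡⟨ fromℤ-⟦⟧ (evar (# 0) ⊠ evar (# 0) ⊞ ⊟ (evar (# 2) ⊠ (evar (# 1) ⊠ evar (# 1)))) (G ∷ H ∷ + m ∷ []) ⟩
     fromℤ G ℚ.* fromℤ G ℚ.- fromℤ (+ m) ℚ.* (fromℤ H ℚ.* fromℤ H)
       ≡⟨ cong₂ (λ x y → x ℚ.* x ℚ.- fromℤ (+ m) ℚ.* (y ℚ.* y)) 2g≡G 2h≡H ⟨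
     (fromℤ (+ 2) ℚ.* g) ℚ.* (fromℤ (+ 2) ℚ.* g) ℚ.- fromℤ (+ m) ℚ.* ((fromℤ (+ 2) ℚ.* h) ℚ.* (fromℤ (+ 2) ℚ.* h))
       ≡⟨ ℚS.solve 3 (λ g h M → (ℚS.con (fromℤ (+ 2)) ℚS.:* g) ℚS.:* (ℚS.con (fromℤ (+ 2)) ℚS.:* g) ℚS.:- M ℚS.:* ((ℚS.con (fromℤ (+ 2)) ℚS.:* h) ℚS.:* (ℚS.con (fromℤ (+ 2)) ℚS.:* h))
              ℚS.:= ℚS.con (fromℤ (+ 4)) ℚS.:* (g ℚS.:* g ℚS.:- M ℚS.:* (h ℚS.:* h))) refl g h (fromℤ (+ m)) ⟩
     fromℤ (+ 4) ℚ.* (g ℚ.* g ℚ.- fromℤ (+ m) ℚ.* (h ℚ.* h)) ≡⟨ cong (fromℤ (+ 4) ℚ.*_) norm≡N ⟩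
     fromℤ (+ 4) ℚ.* fromℤ N                                 ≡⟨ fromℤ-* (+ 4) N ⟨
     fromℤ (+ 4 ℤ.* N) ∎)
    where open ≡-Reasoning
  t = m ℕ./ 4
  m+1≡[t+1]*4 : + m ℤ.+ + 1 ≡ + suc t ℤ.* + 4
  m+1≡[t+1]*4 = begin
    + m ℤ.+ + 1          ≡⟨ cong (λ n → + n ℤ.+ + 1) (trans (m≡m%n+[m/n]*n m 4) (cong (ℕ._+ t ℕ.* 4) m%4≡3)) ⟩
    + (3 ℕ.+ t ℕ.* 4 ℕ.+ 1)   ≡⟨ cong +_ (ℕS.solve 1 (λ t → ℕS.con 3 ℕS.:+ t ℕS.:* ℕS.con 4 ℕS.:+ ℕS.con 1 ℕS.:= (ℕS.con 1 ℕS.:+ t) ℕS.:* ℕS.con 4) refl t) ⟩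
    + (suc t ℕ.* 4)       ≡⟨ ℤP.pos-* (suc t) 4 ⟩
    + suc t ℤ.* + 4       ∎
    where open ≡-Reasoning
  G²+H²≡[N+[t+1]H²]*4 : G ℤ.* G ℤ.+ H ℤ.* H ≡ (N ℤ.+ + suc t ℤ.* (H ℤ.* H)) ℤ.* + 4
  G²+H²≡[N+[t+1]H²]*4 = begin
    G ℤ.* G ℤ.+ H ℤ.* H
      ≡⟨ ℤS.solve 3 (λ G H M → G ℤS.:* G ℤS.:+ H ℤS.:* H ℤS.:= (G ℤS.:* G ℤS.:- M ℤS.:* (H ℤS.:* H)) ℤS.:+ (M ℤS.:+ ℤS.con (+ 1)) ℤS.:* (H ℤS.:* H)) refl G H (+ m) ⟩
    (G ℤ.* G ℤ.- + m ℤ.* (H ℤ.* H)) ℤ.+ (+ m ℤ.+ + 1) ℤ.* (H ℤ.* H)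
      ≡⟨ cong₂ (λ x y → x ℤ.+ y ℤ.* (H ℤ.* H)) G²-mH²≡4N m+1≡[t+1]*4 ⟩
    + 4 ℤ.* N ℤ.+ (+ suc t ℤ.* + 4) ℤ.* (H ℤ.* H)
      ≡⟨ ℤS.solve 3 (λ N T X → ℤS.con (+ 4) ℤS.:* N ℤS.:+ (T ℤS.:* ℤS.con (+ 4)) ℤS.:* X ℤS.:= (N ℤS.:+ T ℤS.:* X) ℤS.:* ℤS.con (+ 4)) refl N (+ suc t) (H ℤ.* H) ⟩
    (N ℤ.+ + suc t ℤ.* (H ℤ.* H)) ℤ.* + 4 ∎
    where open ≡-Reasoning
  2∣G×2∣H : + 2 ℤD.∣ G × + 2 ℤD.∣ H
  2∣G×2∣H = 4∣i²+j²⇒2∣i×2∣j G H (divides (N ℤ.+ + suc t ℤ.* (H ℤ.* H)) G²+H²≡[N+[t+1]H²]*4)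

7-squarefree : SquareFree 7
7-squarefree d d²∣7 with prime⇒irreducible (from-yes (prime? 7)) (ℕD.∣-trans (ℕD.m∣m*n d) d²∣7)
... | inj₁ d≡1 = d≡1
... | inj₂ refl with s≤s (s≤s (s≤s (s≤s (s≤s (s≤s (s≤s ())))))) ← ℕD.∣⇒≤ d²∣7

7*s-squarefree : ∀ s → SquareFree s → ¬ (7 ∣ s) → SquareFree (7 ℕ.* s)
7*s-squarefree s sf 7∤s d d²∣7s with 7 ℕD.∣? d
... | yes (divides k refl) = ⊥-elim (7∤s (7∣s d²∣7s))
  where
  7∣s : (k ℕ.* 7) ℕ.* (k ℕ.* 7) ∣ 7 ℕ.* s → 7 ∣ s
  7∣s (divides j e) = divides (j ℕ.* k ℕ.* k) (ℕP.*-cancelˡ-≡ s (j ℕ.* k ℕ.* k ℕ.* 7) 7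
    (trans e (ℕS.solve 2 (λ j k → j ℕS.:* ((k ℕS.:* ℕS.con 7) ℕS.:* (k ℕS.:* ℕS.con 7)) ℕS.:= ℕS.con 7 ℕS.:* (j ℕS.:* k ℕS.:* k ℕS.:* ℕS.con 7)) refl j k)))
... | no 7∤d = sf d (Coprimality.coprime-divisor d²⊥7 d²∣7s)
  where
  d²⊥7 : Coprime (d ℕ.* d) 7
  d²⊥7 {i} (i∣d² , i∣7) with prime⇒irreducible (from-yes (prime? 7)) i∣7
  ... | inj₁ i≡1 = i≡1
  ... | inj₂ refl with euclidsLemma d d (from-yes (prime? 7)) i∣d²
  ...   | inj₁ 7∣d = ⊥-elim (7∤d 7∣d)
  ...   | inj₂ 7∣d = ⊥-elim (7∤d 7∣d)

⟨⟩-cong : ∀ {s} {a b c d a′ b′ c′ d′ : ℚ} → a ≡ a′ → b ≡ b′ → c ≡ c′ → d ≡ d′ →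
  _≡_ {A = K s} ⟨ a , b , c , d ⟩ ⟨ a′ , b′ , c′ , d′ ⟩
⟨⟩-cong refl refl refl refl = refl

-- Symbolic elements of K, over 18 rational variables: variable 0 stands for s, variable 1 for 7
-- (symbolic, to keep normalisation small) and variables 2–17 for the coordinates of up to four
-- elements of K.
record KExpr : Set where
  constructor ⟪_,_,_,_⟫
  field e1 e7 es e7s : Polynomial 18

infixl 6 _⊕ₑ_
infixl 7 _⊗ₑ_

_⊕ₑ_ _⊗ₑ_ : KExpr → KExpr → KExpr
⟪ a , b , c , d ⟫ ⊕ₑ ⟪ a′ , b′ , c′ , d′ ⟫ = ⟪ a :+ a′ , b :+ b′ , c :+ c′ , d :+ d′ ⟫
⟪ a , b , c , d ⟫ ⊗ₑ ⟪ a′ , b′ , c′ , d′ ⟫ =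
  ⟪ a :* a′ :+ q7 :* b :* b′ :+ S :* c :* c′ :+ q7 :* S :* d :* d′
  , a :* b′ :+ b :* a′ :+ S :* (c :* d′ :+ d :* c′)
  , a :* c′ :+ c :* a′ :+ q7 :* (b :* d′ :+ d :* b′)
  , a :* d′ :+ d :* a′ :+ b :* c′ :+ c :* b′ ⟫
  where
  S q7 : Polynomial 18
  S = var (# 0)
  q7 = var (# 1)

ratₑ : Polynomial 18 → KExpr
ratₑ p = ⟪ p , con 0ℚ , con 0ℚ , con 0ℚ ⟫

𝟙ₑ : KExpr
𝟙ₑ = ratₑ (con 1ℚ)

x₀ x₁ x₂ x₃ : KExpr
x₀ = ⟪ var (# 2) , var (# 3) , var (# 4) , var (# 5) ⟫
x₁ = ⟪ var (# 6) , var (# 7) , var (# 8) , var (# 9) ⟫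
x₂ = ⟪ var (# 10) , var (# 11) , var (# 12) , var (# 13) ⟫
x₃ = ⟪ var (# 14) , var (# 15) , var (# 16) , var (# 17) ⟫

σ₇ₑ σₛₑ σ₇ₛₑ : KExpr → KExpr
σ₇ₑ ⟪ a , b , c , d ⟫ = ⟪ a , :- b , c , :- d ⟫
σₛₑ ⟪ a , b , c , d ⟫ = ⟪ a , b , :- c , :- d ⟫
σ₇ₛₑ ⟪ a , b , c , d ⟫ = ⟪ a , :- b , :- c , d ⟫

module _ {s : ℕ} where

  coords : K s → Vec ℚ 4
  coords ⟨ a , b , c , d ⟩ = a ∷ b ∷ c ∷ d ∷ []

  env : K s → K s → K s → K s → Vec ℚ 18
  env x y z w = + s / 1 ∷ + 7 / 1 ∷ coords x Vec.++ coords y Vec.++ coords z Vec.++ coords w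

  ⟦_⟧ₖ : KExpr → Vec ℚ 18 → K s
  ⟦ ⟪ a , b , c , d ⟫ ⟧ₖ ρ = ⟨ ⟦ a ⟧ ρ , ⟦ b ⟧ ρ , ⟦ c ⟧ ρ , ⟦ d ⟧ ρ ⟩

  -- The four hypotheses are the solver's normal-form equations, discharged by refl.
  K-solve : ∀ (ρ : Vec ℚ 18) (X Y : KExpr) →
    ⟦ KExpr.e1 X ⟧↓ ρ ≡ ⟦ KExpr.e1 Y ⟧↓ ρ → ⟦ KExpr.e7 X ⟧↓ ρ ≡ ⟦ KExpr.e7 Y ⟧↓ ρ →
    ⟦ KExpr.es X ⟧↓ ρ ≡ ⟦ KExpr.es Y ⟧↓ ρ → ⟦ KExpr.e7s X ⟧↓ ρ ≡ ⟦ KExpr.e7s Y ⟧↓ ρ →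
    ⟦ X ⟧ₖ ρ ≡ ⟦ Y ⟧ₖ ρ
  K-solve ρ ⟪ a , b , c , d ⟫ ⟪ a′ , b′ , c′ , d′ ⟫ p q r t =
    ⟨⟩-cong (prove ρ a a′ p) (prove ρ b b′ q) (prove ρ c c′ r) (prove ρ d d′ t)

  rat : ℚ → K s
  rat q = ⟨ q , 0ℚ , 0ℚ , 0ℚ ⟩

  infixr 7 _·_

  _·_ : ℚ → K s → K s
  q · ⟨ a , b , c , d ⟩ = ⟨ q ℚ.* a , q ℚ.* b , q ℚ.* c , q ℚ.* d ⟩

  ⊖_ : K s → K s
  ⊖ ⟨ a , b , c , d ⟩ = ⟨ ℚ.- a , ℚ.- b , ℚ.- c , ℚ.- d ⟩

  pow : K s → ℕ → K s
  pow x zero = 𝟙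
  pow x (suc k) = x ⊗ pow x k

  ⊗-assoc : (x y z : K s) → (x ⊗ y) ⊗ z ≡ x ⊗ (y ⊗ z)
  ⊗-assoc x y z = K-solve (env x y z 𝟘) ((x₀ ⊗ₑ x₁) ⊗ₑ x₂) (x₀ ⊗ₑ (x₁ ⊗ₑ x₂)) refl refl refl refl

  ⊗-distribˡ-⊕ : (x y z : K s) → x ⊗ (y ⊕ z) ≡ x ⊗ y ⊕ x ⊗ z
  ⊗-distribˡ-⊕ x y z = K-solve (env x y z 𝟘) (x₀ ⊗ₑ (x₁ ⊕ₑ x₂)) (x₀ ⊗ₑ x₁ ⊕ₑ x₀ ⊗ₑ x₂) refl refl refl refl

  ⊗-distribʳ-⊕ : (x y z : K s) → (y ⊕ z) ⊗ x ≡ y ⊗ x ⊕ z ⊗ x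
  ⊗-distribʳ-⊕ x y z = K-solve (env x y z 𝟘) ((x₁ ⊕ₑ x₂) ⊗ₑ x₀) (x₁ ⊗ₑ x₀ ⊕ₑ x₂ ⊗ₑ x₀) refl refl refl refl

  ⊗-identityˡ : (x : K s) → 𝟙 ⊗ x ≡ x
  ⊗-identityˡ x = K-solve (env x 𝟘 𝟘 𝟘) (𝟙ₑ ⊗ₑ x₀) x₀ refl refl refl refl

  ⊗-identityʳ : (x : K s) → x ⊗ 𝟙 ≡ x
  ⊗-identityʳ x = K-solve (env x 𝟘 𝟘 𝟘) (x₀ ⊗ₑ 𝟙ₑ) x₀ refl refl refl refl

  ⊕-identityˡ : (x : K s) → 𝟘 ⊕ x ≡ x
  ⊕-identityˡ x = K-solve (env x 𝟘 𝟘 𝟘) (ratₑ (con 0ℚ) ⊕ₑ x₀) x₀ refl refl refl refl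

  ⊗-zeroˡ : (x : K s) → 𝟘 ⊗ x ≡ 𝟘
  ⊗-zeroˡ x = K-solve (env x 𝟘 𝟘 𝟘) (ratₑ (con 0ℚ) ⊗ₑ x₀) (ratₑ (con 0ℚ)) refl refl refl refl

  ⊗-zeroʳ : (x : K s) → x ⊗ 𝟘 ≡ 𝟘
  ⊗-zeroʳ x = K-solve (env x 𝟘 𝟘 𝟘) (x₀ ⊗ₑ ratₑ (con 0ℚ)) (ratₑ (con 0ℚ)) refl refl refl refl

  ⊕-⊖-cancelʳ : (x y : K s) → (x ⊕ y) ⊕ ⊖ x ≡ y
  ⊕-⊖-cancelʳ x y = K-solve (env x y 𝟘 𝟘) (x₀ ⊕ₑ x₁ ⊕ₑ ⟪ :- KExpr.e1 x₀ , :- KExpr.e7 x₀ , :- KExpr.es x₀ , :- KExpr.e7s x₀ ⟫) x₁ refl refl refl refl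

  ⊗-left-comm : (x y z : K s) → x ⊗ (y ⊗ z) ≡ y ⊗ (x ⊗ z)
  ⊗-left-comm x y z = K-solve (env x y z 𝟘) (x₀ ⊗ₑ (x₁ ⊗ₑ x₂)) (x₁ ⊗ₑ (x₀ ⊗ₑ x₂)) refl refl refl refl

  ⊗-interchange : (x y z w : K s) → (x ⊗ y) ⊗ (z ⊗ w) ≡ (x ⊗ z) ⊗ (y ⊗ w)
  ⊗-interchange x y z w = K-solve (env x y z w) ((x₀ ⊗ₑ x₁) ⊗ₑ (x₂ ⊗ₑ x₃)) ((x₀ ⊗ₑ x₂) ⊗ₑ (x₁ ⊗ₑ x₃)) refl refl refl refl

  rat-⊗ : ∀ q (x : K s) → rat q ⊗ x ≡ q · x
  rat-⊗ q x = K-solve (env x (rat q) 𝟘 𝟘) (ratₑ (var (# 6)) ⊗ₑ x₀)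
    ⟪ var (# 6) :* KExpr.e1 x₀ , var (# 6) :* KExpr.e7 x₀ , var (# 6) :* KExpr.es x₀ , var (# 6) :* KExpr.e7s x₀ ⟫ refl refl refl refl

  rat-* : ∀ p q → rat (p ℚ.* q) ≡ rat p ⊗ rat q
  rat-* p q = sym (K-solve (env (rat p) (rat q) 𝟘 𝟘) (ratₑ (var (# 2)) ⊗ₑ ratₑ (var (# 6))) (ratₑ (var (# 2) :* var (# 6))) refl refl refl refl)

  ι-* : ∀ a b → ι {s} (a ℤ.* b) ≡ ι a ⊗ ι b
  ι-* a b = trans (cong rat (fromℤ-* a b)) (rat-* (fromℤ a) (fromℤ b))

  σ₇ σₛ σ₇ₛ : K s → K s
  σ₇ ⟨ a , b , c , d ⟩ = ⟨ a , ℚ.- b , c , ℚ.- d ⟩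
  σₛ ⟨ a , b , c , d ⟩ = ⟨ a , b , ℚ.- c , ℚ.- d ⟩
  σ₇ₛ ⟨ a , b , c , d ⟩ = ⟨ a , ℚ.- b , ℚ.- c , d ⟩

  σ₇-⊗ : (x y : K s) → σ₇ (x ⊗ y) ≡ σ₇ x ⊗ σ₇ y
  σ₇-⊗ x y = K-solve (env x y 𝟘 𝟘) (σ₇ₑ (x₀ ⊗ₑ x₁)) (σ₇ₑ x₀ ⊗ₑ σ₇ₑ x₁) refl refl refl refl

  σₛ-⊗ : (x y : K s) → σₛ (x ⊗ y) ≡ σₛ x ⊗ σₛ y
  σₛ-⊗ x y = K-solve (env x y 𝟘 𝟘) (σₛₑ (x₀ ⊗ₑ x₁)) (σₛₑ x₀ ⊗ₑ σₛₑ x₁) refl refl refl refl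

  σ₇ₛ-⊗ : (x y : K s) → σ₇ₛ (x ⊗ y) ≡ σ₇ₛ x ⊗ σ₇ₛ y
  σ₇ₛ-⊗ x y = K-solve (env x y 𝟘 𝟘) (σ₇ₛₑ (x₀ ⊗ₑ x₁)) (σ₇ₛₑ x₀ ⊗ₑ σ₇ₛₑ x₁) refl refl refl refl

  pow-+ : ∀ (x : K s) a b → pow x (a ℕ.+ b) ≡ pow x a ⊗ pow x b
  pow-+ x zero b = sym (⊗-identityˡ (pow x b))
  pow-+ x (suc a) b = trans (cong (x ⊗_) (pow-+ x a b)) (sym (⊗-assoc x (pow x a) (pow x b)))

  pow-homo : ∀ (f : K s → K s) → f 𝟙 ≡ 𝟙 → (∀ x y → f (x ⊗ y) ≡ f x ⊗ f y) → ∀ x k → f (pow x k) ≡ pow (f x) k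
  pow-homo f f𝟙 f-⊗ x zero = f𝟙
  pow-homo f f𝟙 f-⊗ x (suc k) = trans (f-⊗ x (pow x k)) (cong (f x ⊗_) (pow-homo f f𝟙 f-⊗ x k))

module _ {s : ℕ} where

  record IntegralCoords (x : K s) : Set where
    constructor integralCoords
    field
      c1 : Integral (K.c1 x)
      c7 : Integral (K.c7 x)
      cs : Integral (K.cs x)
      c7s : Integral (K.c7s x)

  IntegralCoords-⊕ : ∀ {x y} → IntegralCoords x → IntegralCoords y → IntegralCoords (x ⊕ y)
  IntegralCoords-⊕ (integralCoords a b c d) (integralCoords a′ b′ c′ d′) =
    integralCoords (Integral-+ a a′) (Integral-+ b b′) (Integral-+ c c′) (Integral-+ d d′)

  IntegralCoords-⊗ : ∀ {x y} → IntegralCoords x → IntegralCoords y → IntegralCoords (x ⊗ y)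
  IntegralCoords-⊗ (integralCoords a b c d) (integralCoords a′ b′ c′ d′) = integralCoords
    (Integral-+ (Integral-+ (Integral-+ (Integral-* a a′) (Integral-* (Integral-* q7 b) b′)) (Integral-* (Integral-* qS c) c′)) (Integral-* (Integral-* (Integral-* q7 qS) d) d′))
    (Integral-+ (Integral-+ (Integral-* a b′) (Integral-* b a′)) (Integral-* qS (Integral-+ (Integral-* c d′) (Integral-* d c′))))
    (Integral-+ (Integral-+ (Integral-* a c′) (Integral-* c a′)) (Integral-* q7 (Integral-+ (Integral-* b d′) (Integral-* d b′))))
    (Integral-+ (Integral-+ (Integral-+ (Integral-* a d′) (Integral-* d a′)) (Integral-* b c′)) (Integral-* c b′))
    where
    q7 : Integral (+ 7 / 1)
    q7 = + 7 , refl
    qS : Integral (+ s / 1)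
    qS = + s , refl

  IntegralCoords-ι : ∀ z → IntegralCoords (ι {s} z)
  IntegralCoords-ι z = integralCoords (z , refl) (+ 0 , refl) (+ 0 , refl) (+ 0 , refl)

  IntegralCoords-σ₇ : ∀ {x} → IntegralCoords x → IntegralCoords (σ₇ x)
  IntegralCoords-σ₇ (integralCoords a b c d) = integralCoords a (Integral-neg b) c (Integral-neg d)

  IntegralCoords-σₛ : ∀ {x} → IntegralCoords x → IntegralCoords (σₛ x)
  IntegralCoords-σₛ (integralCoords a b c d) = integralCoords a b (Integral-neg c) (Integral-neg d)

  IntegralCoords-σ₇ₛ : ∀ {x} → IntegralCoords x → IntegralCoords (σ₇ₛ x)
  IntegralCoords-σ₇ₛ (integralCoords a b c d) = integralCoords a (Integral-neg b) (Integral-neg c) d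

  record HasDenominator (L : ℕ) (u : K s) : Set where
    constructor hasDenominator
    field integral-multiple : IntegralCoords (ι (+ L) ⊗ u)

  HasDenominator-⊕ : ∀ {L u v} → HasDenominator L u → HasDenominator L v → HasDenominator L (u ⊕ v)
  HasDenominator-⊕ {L} {u} {v} (hasDenominator p) (hasDenominator q) =
    hasDenominator (subst IntegralCoords (sym (⊗-distribˡ-⊕ (ι (+ L)) u v)) (IntegralCoords-⊕ p q))

  HasDenominator-ι⊗ : ∀ {L u} z → HasDenominator L u → HasDenominator L (ι z ⊗ u)
  HasDenominator-ι⊗ {L} {u} z (hasDenominator p) =
    hasDenominator (subst IntegralCoords (⊗-left-comm (ι z) (ι (+ L)) u) (IntegralCoords-⊗ (IntegralCoords-ι z) p))

  HasDenominator-𝟘 : ∀ {L} → HasDenominator L 𝟘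
  HasDenominator-𝟘 {L} = hasDenominator (subst IntegralCoords (sym (⊗-zeroʳ (ι (+ L)))) (IntegralCoords-ι (+ 0)))

  HasDenominator-⊗ : ∀ {A B u v} → HasDenominator A u → HasDenominator B v → HasDenominator (A ℕ.* B) (u ⊗ v)
  HasDenominator-⊗ {A} {B} {u} {v} (hasDenominator p) (hasDenominator q) =
    hasDenominator (subst IntegralCoords (sym eq) (IntegralCoords-⊗ p q))
    where
    eq : ι (+ (A ℕ.* B)) ⊗ (u ⊗ v) ≡ (ι (+ A) ⊗ u) ⊗ (ι (+ B) ⊗ v)
    eq = trans (cong (λ t → ι t ⊗ (u ⊗ v)) (ℤP.pos-* A B))
      (trans (cong (_⊗ (u ⊗ v)) (ι-* (+ A) (+ B))) (⊗-interchange (ι (+ A)) (ι (+ B)) u v))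

  HasDenominator-*ˡ : ∀ M {L u} → HasDenominator L u → HasDenominator (M ℕ.* L) u
  HasDenominator-*ˡ M {L} {u} (hasDenominator p) =
    hasDenominator (subst IntegralCoords (sym eq) (IntegralCoords-⊗ (IntegralCoords-ι (+ M)) p))
    where
    eq : ι (+ (M ℕ.* L)) ⊗ u ≡ ι (+ M) ⊗ (ι (+ L) ⊗ u)
    eq = trans (cong (λ t → ι t ⊗ u) (ℤP.pos-* M L)) (trans (cong (_⊗ u) (ι-* (+ M) (+ L))) (⊗-assoc (ι (+ M)) (ι (+ L)) u))

  HasDenominator-map : ∀ (f : K s → K s) → (∀ x y → f (x ⊗ y) ≡ f x ⊗ f y) → (∀ z → f (ι z) ≡ ι z) →
    (∀ {x} → IntegralCoords x → IntegralCoords (f x)) → ∀ {L u} → HasDenominator L u → HasDenominator L (f u)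
  HasDenominator-map f f-⊗ f-ι f-integral {L} {u} (hasDenominator p) =
    hasDenominator (subst IntegralCoords (trans (f-⊗ (ι (+ L)) u) (cong (_⊗ f u) (f-ι (+ L)))) (f-integral p))

  ∃-denominator : ∀ x → Σ ℕ λ L → HasDenominator (suc L) x
  ∃-denominator x@(⟨ a , b , c , d ⟩) = ℕ.pred (da ℕ.* db ℕ.* dc ℕ.* dd) , hasDenominator (subst IntegralCoords (sym (rat-⊗ (fromℤ (+ (da ℕ.* db ℕ.* dc ℕ.* dd))) x)) (integralCoords
    (subst (λ t → Integral (fromℤ (+ t) ℚ.* a)) shuffleᵃ (multiple-of-↧-Integral (db ℕ.* dc ℕ.* dd) a))
    (subst (λ t → Integral (fromℤ (+ t) ℚ.* b)) shuffleᵇ (multiple-of-↧-Integral (da ℕ.* dc ℕ.* dd) b))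
    (subst (λ t → Integral (fromℤ (+ t) ℚ.* c)) shuffleᶜ (multiple-of-↧-Integral (da ℕ.* db ℕ.* dd) c))
    (multiple-of-↧-Integral (da ℕ.* db ℕ.* dc) d)))
    where
    da = ↧ₙ a
    db = ↧ₙ b
    dc = ↧ₙ c
    dd = ↧ₙ d
    shuffleᵃ : (db ℕ.* dc ℕ.* dd) ℕ.* da ≡ da ℕ.* db ℕ.* dc ℕ.* dd
    shuffleᵃ = ℕS.solve 4 (λ a b c d → (b ℕS.:* c ℕS.:* d) ℕS.:* a ℕS.:= a ℕS.:* b ℕS.:* c ℕS.:* d) refl da db dc dd
    shuffleᵇ : (da ℕ.* dc ℕ.* dd) ℕ.* db ≡ da ℕ.* db ℕ.* dc ℕ.* dd
    shuffleᵇ = ℕS.solve 4 (λ a b c d → (a ℕS.:* c ℕS.:* d) ℕS.:* b ℕS.:= a ℕS.:* b ℕS.:* c ℕS.:* d) refl da db dc dd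
    shuffleᶜ : (da ℕ.* db ℕ.* dd) ℕ.* dc ≡ da ℕ.* db ℕ.* dc ℕ.* dd
    shuffleᶜ = ℕS.solve 4 (λ a b c d → (a ℕS.:* b ℕS.:* d) ℕS.:* c ℕS.:= a ℕS.:* b ℕS.:* c ℕS.:* d) refl da db dc dd

  ∃-common-denominator : ∀ (gs : List (K s)) → Σ ℕ λ L → ∀ {g} → g ∈ gs → HasDenominator (suc L) g
  ∃-common-denominator [] = 0 , λ ()
  ∃-common-denominator (g ∷ gs) = ℕ.pred (suc D ℕ.* suc L) , λ
    { (here refl) → subst (λ M → HasDenominator M g) (ℕP.*-comm (suc L) (suc D)) (HasDenominator-*ˡ (suc L) g-den)
    ; (there g∈gs) → HasDenominator-*ˡ (suc D) (gs-den g∈gs) }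
    where
    D = proj₁ (∃-denominator g)
    g-den = proj₂ (∃-denominator g)
    L = proj₁ (∃-common-denominator gs)
    gs-den = proj₂ (∃-common-denominator gs)

  infixl 6 _⊕ₛ_

  data Span (G : K s → Set) : K s → Set where
    gen : ∀ {g} → G g → Span G g
    span-𝟘 : Span G 𝟘
    _⊕ₛ_ : ∀ {u v} → Span G u → Span G v → Span G (u ⊕ v)
    scale : ∀ z {u} → Span G u → Span G (ι z ⊗ u)

  Span-HasDenominator : ∀ {G L} → (∀ {g} → G g → HasDenominator L g) → ∀ {u} → Span G u → HasDenominator L u
  Span-HasDenominator G-den (gen g) = G-den g
  Span-HasDenominator G-den span-𝟘 = HasDenominator-𝟘
  Span-HasDenominator G-den (p ⊕ₛ q) = HasDenominator-⊕ (Span-HasDenominator G-den p) (Span-HasDenominator G-den q)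
  Span-HasDenominator G-den (scale z p) = HasDenominator-ι⊗ z (Span-HasDenominator G-den p)

  Span-⊗ˡ : ∀ {G} y → (∀ {g} → G g → Span G (y ⊗ g)) → ∀ {u} → Span G u → Span G (y ⊗ u)
  Span-⊗ˡ y y⊗G (gen g) = y⊗G g
  Span-⊗ˡ y y⊗G span-𝟘 = subst (Span _) (sym (⊗-zeroʳ y)) span-𝟘
  Span-⊗ˡ y y⊗G (_⊕ₛ_ {u} {v} p q) = subst (Span _) (sym (⊗-distribˡ-⊕ y u v)) (Span-⊗ˡ y y⊗G p ⊕ₛ Span-⊗ˡ y y⊗G q)
  Span-⊗ˡ y y⊗G (scale z {u} p) = subst (Span _) (⊗-left-comm (ι z) y u) (scale z (Span-⊗ˡ y y⊗G p))

  Span-⊗ : ∀ {G} → (∀ {g h} → G g → G h → G (g ⊗ h)) → ∀ {u v} → Span G u → Span G v → Span G (u ⊗ v)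
  Span-⊗ G-⊗ {u = u} (gen g) q = Span-⊗ˡ u (λ h → gen (G-⊗ g h)) q
  Span-⊗ G-⊗ {v = v} span-𝟘 q = subst (Span _) (sym (⊗-zeroˡ v)) span-𝟘
  Span-⊗ G-⊗ {v = w} (_⊕ₛ_ {u} {v} p₁ p₂) q = subst (Span _) (sym (⊗-distribʳ-⊕ w u v)) (Span-⊗ G-⊗ p₁ q ⊕ₛ Span-⊗ G-⊗ p₂ q)
  Span-⊗ G-⊗ {v = v} (scale z {u} p) q = subst (Span _) (sym (⊗-assoc (ι z) u v)) (scale z (Span-⊗ G-⊗ p q))

  Span-pow : ∀ {G} x → G 𝟙 → (∀ {g} → G g → Span G (x ⊗ g)) → ∀ k → Span G (pow x k)
  Span-pow x G𝟙 x⊗G zero = gen G𝟙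
  Span-pow x G𝟙 x⊗G (suc k) = Span-⊗ˡ x x⊗G (Span-pow x G𝟙 x⊗G k)

  -- The values at x of the tails cₖ + … + x^(n-k-1) of a monic polynomial c₀ + … + x^n (Horner's
  -- scheme): multiplication by x sends each to the previous one minus an integer, and the first
  -- to the value of the polynomial.
  horner-tails : K s → List ℤ → List (K s)
  horner-tails x [] = []
  horner-tails x (c ∷ cs) = evalMonic cs x ∷ horner-tails x cs

  𝟙∈horner-tails : ∀ x c cs → 𝟙 ∈ horner-tails x (c ∷ cs)
  𝟙∈horner-tails x c [] = here refl
  𝟙∈horner-tails x c (c′ ∷ cs) = there (𝟙∈horner-tails x c′ cs)

  horner-tails-⊗ : ∀ {G} x cs → Span G (evalMonic cs x) → (∀ {g} → g ∈ horner-tails x cs → G g) → G 𝟙 →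
    ∀ {g} → g ∈ horner-tails x cs → Span G (x ⊗ g)
  horner-tails-⊗ {G} x (c ∷ cs) p tails⊆G G𝟙 (here refl) = subst (Span G) eq (p ⊕ₛ scale (ℤ.- c) (gen G𝟙))
    where
    eq : evalMonic (c ∷ cs) x ⊕ ι (ℤ.- c) ⊗ 𝟙 ≡ x ⊗ evalMonic cs x
    eq = trans (cong (evalMonic (c ∷ cs) x ⊕_) (trans (⊗-identityʳ _) (cong rat (fromℤ-neg c))))
               (⊕-⊖-cancelʳ (ι c) (x ⊗ evalMonic cs x))
  horner-tails-⊗ x (c ∷ cs) p tails⊆G G𝟙 (there g∈) = horner-tails-⊗ x cs (gen (tails⊆G (here refl))) (λ g∈′ → tails⊆G (there g∈′)) G𝟙 g∈

  BoundedDenominators : K s → Set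
  BoundedDenominators x = Σ ℕ λ L → ∀ k → HasDenominator (suc L) (pow x k)

  -- The powers of an algebraic integer of degree n lie in the ℤ-span of 1, …, x^(n-1).
  IsAlgInt⇒BoundedDenominators : ∀ x → IsAlgInt x → BoundedDenominators x
  IsAlgInt⇒BoundedDenominators x ([] , 𝟙≡𝟘) = ⊥-elim (ℚP.1≢0 (cong K.c1 𝟙≡𝟘))
  IsAlgInt⇒BoundedDenominators x (c ∷ cs , root) = L , λ k → Span-HasDenominator tails-den
    (Span-pow x (𝟙∈horner-tails x c cs) (horner-tails-⊗ x (c ∷ cs) (subst (Span _) (sym root) span-𝟘) (λ g∈ → g∈) (𝟙∈horner-tails x c cs)) k)
    where
    L = proj₁ (∃-common-denominator (horner-tails x (c ∷ cs)))
    tails-den = proj₂ (∃-common-denominator (horner-tails x (c ∷ cs)))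

module _ {s : ℕ} where

  BoundedDenominators-map : ∀ (f : K s → K s) → f 𝟙 ≡ 𝟙 → (∀ x y → f (x ⊗ y) ≡ f x ⊗ f y) → (∀ z → f (ι z) ≡ ι z) →
    (∀ {x} → IntegralCoords x → IntegralCoords (f x)) → ∀ {x} → BoundedDenominators x → BoundedDenominators (f x)
  BoundedDenominators-map f f𝟙 f-⊗ f-ι f-integral {x} (L , x-den) =
    L , λ k → subst (HasDenominator (suc L)) (pow-homo f f𝟙 f-⊗ x k) (HasDenominator-map f f-⊗ f-ι f-integral (x-den k))

  data Monomial (y₀ y₁ y₂ y₃ : K s) : K s → Set where
    monomial : ∀ e₀ e₁ e₂ e₃ → Monomial y₀ y₁ y₂ y₃ (pow y₀ e₀ ⊗ (pow y₁ e₁ ⊗ (pow y₂ e₂ ⊗ pow y₃ e₃)))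

  module _ {y₀ y₁ y₂ y₃ : K s} where

    Monomial-⊗ : ∀ {u v} → Monomial y₀ y₁ y₂ y₃ u → Monomial y₀ y₁ y₂ y₃ v → Monomial y₀ y₁ y₂ y₃ (u ⊗ v)
    Monomial-⊗ (monomial e₀ e₁ e₂ e₃) (monomial f₀ f₁ f₂ f₃) = subst (Monomial y₀ y₁ y₂ y₃) eq (monomial (e₀ ℕ.+ f₀) (e₁ ℕ.+ f₁) (e₂ ℕ.+ f₂) (e₃ ℕ.+ f₃))
      where
      open ≡-Reasoning
      P₀ = pow y₀ e₀ ; P₁ = pow y₁ e₁ ; P₂ = pow y₂ e₂ ; P₃ = pow y₃ e₃
      Q₀ = pow y₀ f₀ ; Q₁ = pow y₁ f₁ ; Q₂ = pow y₂ f₂ ; Q₃ = pow y₃ f₃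
      eq : pow y₀ (e₀ ℕ.+ f₀) ⊗ (pow y₁ (e₁ ℕ.+ f₁) ⊗ (pow y₂ (e₂ ℕ.+ f₂) ⊗ pow y₃ (e₃ ℕ.+ f₃)))
         ≡ (P₀ ⊗ (P₁ ⊗ (P₂ ⊗ P₃))) ⊗ (Q₀ ⊗ (Q₁ ⊗ (Q₂ ⊗ Q₃)))
      eq = begin
        pow y₀ (e₀ ℕ.+ f₀) ⊗ (pow y₁ (e₁ ℕ.+ f₁) ⊗ (pow y₂ (e₂ ℕ.+ f₂) ⊗ pow y₃ (e₃ ℕ.+ f₃)))
          ≡⟨ cong₂ _⊗_ (pow-+ y₀ e₀ f₀) (cong₂ _⊗_ (pow-+ y₁ e₁ f₁) (cong₂ _⊗_ (pow-+ y₂ e₂ f₂) (pow-+ y₃ e₃ f₃))) ⟩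
        (P₀ ⊗ Q₀) ⊗ ((P₁ ⊗ Q₁) ⊗ ((P₂ ⊗ Q₂) ⊗ (P₃ ⊗ Q₃)))
          ≡⟨ cong (λ t → (P₀ ⊗ Q₀) ⊗ ((P₁ ⊗ Q₁) ⊗ t)) (⊗-interchange P₂ P₃ Q₂ Q₃) ⟨
        (P₀ ⊗ Q₀) ⊗ ((P₁ ⊗ Q₁) ⊗ ((P₂ ⊗ P₃) ⊗ (Q₂ ⊗ Q₃)))
          ≡⟨ cong ((P₀ ⊗ Q₀) ⊗_) (⊗-interchange P₁ (P₂ ⊗ P₃) Q₁ (Q₂ ⊗ Q₃)) ⟨
        (P₀ ⊗ Q₀) ⊗ ((P₁ ⊗ (P₂ ⊗ P₃)) ⊗ (Q₁ ⊗ (Q₂ ⊗ Q₃)))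
          ≡⟨ ⊗-interchange P₀ (P₁ ⊗ (P₂ ⊗ P₃)) Q₀ (Q₁ ⊗ (Q₂ ⊗ Q₃)) ⟨
        (P₀ ⊗ (P₁ ⊗ (P₂ ⊗ P₃))) ⊗ (Q₀ ⊗ (Q₁ ⊗ (Q₂ ⊗ Q₃))) ∎

    Monomial-𝟙 : Monomial y₀ y₁ y₂ y₃ 𝟙
    Monomial-𝟙 = subst (Monomial y₀ y₁ y₂ y₃) (trans (⊗-identityˡ _) (trans (⊗-identityˡ _) (⊗-identityˡ 𝟙))) (monomial 0 0 0 0)

    Span-Monomial-pow : ∀ {u} → Span (Monomial y₀ y₁ y₂ y₃) u → ∀ k → Span (Monomial y₀ y₁ y₂ y₃) (pow u k)
    Span-Monomial-pow p zero = gen Monomial-𝟙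
    Span-Monomial-pow p (suc k) = Span-⊗ Monomial-⊗ p (Span-Monomial-pow p k)

    Monomial-HasDenominator : ∀ {L} → (∀ k → HasDenominator L (pow y₀ k)) → (∀ k → HasDenominator L (pow y₁ k)) →
      (∀ k → HasDenominator L (pow y₂ k)) → (∀ k → HasDenominator L (pow y₃ k)) →
      ∀ {u} → Monomial y₀ y₁ y₂ y₃ u → HasDenominator (L ℕ.* (L ℕ.* (L ℕ.* L))) u
    Monomial-HasDenominator h₀ h₁ h₂ h₃ (monomial e₀ e₁ e₂ e₃) = HasDenominator-⊗ (h₀ e₀) (HasDenominator-⊗ (h₁ e₁) (HasDenominator-⊗ (h₂ e₂) (h₃ e₃)))

    y₀∈Span : Span (Monomial y₀ y₁ y₂ y₃) y₀
    y₀∈Span = gen (subst (Monomial y₀ y₁ y₂ y₃) (K-solve (env y₀ 𝟘 𝟘 𝟘) ((x₀ ⊗ₑ 𝟙ₑ) ⊗ₑ (𝟙ₑ ⊗ₑ (𝟙ₑ ⊗ₑ 𝟙ₑ))) x₀ refl refl refl refl) (monomial 1 0 0 0))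
    y₁∈Span : Span (Monomial y₀ y₁ y₂ y₃) y₁
    y₁∈Span = gen (subst (Monomial y₀ y₁ y₂ y₃) (K-solve (env y₁ 𝟘 𝟘 𝟘) (𝟙ₑ ⊗ₑ ((x₀ ⊗ₑ 𝟙ₑ) ⊗ₑ (𝟙ₑ ⊗ₑ 𝟙ₑ))) x₀ refl refl refl refl) (monomial 0 1 0 0))
    y₂∈Span : Span (Monomial y₀ y₁ y₂ y₃) y₂
    y₂∈Span = gen (subst (Monomial y₀ y₁ y₂ y₃) (K-solve (env y₂ 𝟘 𝟘 𝟘) (𝟙ₑ ⊗ₑ (𝟙ₑ ⊗ₑ ((x₀ ⊗ₑ 𝟙ₑ) ⊗ₑ 𝟙ₑ))) x₀ refl refl refl refl) (monomial 0 0 1 0))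
    y₃∈Span : Span (Monomial y₀ y₁ y₂ y₃) y₃
    y₃∈Span = gen (subst (Monomial y₀ y₁ y₂ y₃) (K-solve (env y₃ 𝟘 𝟘 𝟘) (𝟙ₑ ⊗ₑ (𝟙ₑ ⊗ₑ (𝟙ₑ ⊗ₑ (x₀ ⊗ₑ 𝟙ₑ)))) x₀ refl refl refl refl) (monomial 0 0 0 1))

  rat-pow : ∀ q k → pow (rat {s} q) k ≡ rat (q ^ℚ k)
  rat-pow q zero = refl
  rat-pow q (suc k) = trans (cong (rat q ⊗_) (rat-pow q k)) (sym (rat-* q (q ^ℚ k)))

  ℤ[conjugates] : K s → K s → Set
  ℤ[conjugates] x = Span (Monomial x (σ₇ x) (σₛ x) (σ₇ₛ x))

  -- This ring has bounded denominators, so a rational q in it has all qᵏ with a common denominator.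
  ℤ[conjugates]-rat⇒Integral : ∀ {x} → IsAlgInt x → ∀ q → ℤ[conjugates] x (rat q) → Integral q
  ℤ[conjugates]-rat⇒Integral {x} x-int q q∈ = bounded-powers⇒Integral q (ℕ.pred L⁴) λ k →
    IntegralCoords.c1 (subst IntegralCoords (trans (cong (ι (+ L⁴) ⊗_) (rat-pow q k)) (rat-⊗ (fromℤ (+ L⁴)) (rat (q ^ℚ k))))
      (HasDenominator.integral-multiple (Span-HasDenominator (Monomial-HasDenominator x-den σ₇x-den σₛx-den σ₇ₛx-den) (Span-Monomial-pow q∈ k))))
    where
    x-bounded : BoundedDenominators x
    x-bounded = IsAlgInt⇒BoundedDenominators x x-int
    L L⁴ : ℕ
    L = proj₁ x-bounded
    L⁴ = suc L ℕ.* (suc L ℕ.* (suc L ℕ.* suc L))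
    x-den : ∀ k → HasDenominator (suc L) (pow x k)
    x-den = proj₂ x-bounded
    σ₇x-den : ∀ k → HasDenominator (suc L) (pow (σ₇ x) k)
    σ₇x-den = proj₂ (BoundedDenominators-map σ₇ refl σ₇-⊗ (λ _ → refl) IntegralCoords-σ₇ x-bounded)
    σₛx-den : ∀ k → HasDenominator (suc L) (pow (σₛ x) k)
    σₛx-den = proj₂ (BoundedDenominators-map σₛ refl σₛ-⊗ (λ _ → refl) IntegralCoords-σₛ x-bounded)
    σ₇ₛx-den : ∀ k → HasDenominator (suc L) (pow (σ₇ₛ x) k)
    σ₇ₛx-den = proj₂ (BoundedDenominators-map σ₇ₛ refl σ₇ₛ-⊗ (λ _ → refl) IntegralCoords-σ₇ₛ x-bounded)

record IntegerForm {s : ℕ} (x : K s) : Set where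
  constructor integerForm
  field
    A B C D : ℤ
    x≡ : x ≡ ⟨ fromℤ A ℚ.* ½ , fromℤ B ℚ.* ½ , fromℤ C ℚ.* ½ , fromℤ D ℚ.* ½ ⟩
    2∣A+D : + 2 ℤD.∣ A ℤ.+ D
    2∣B+C : + 2 ℤD.∣ B ℤ.+ C

two : ℚ
two = fromℤ (+ 2)

-- The norms of x = a + b√7 + c√s + d√7s down to ℚ(√s) and ℚ(√7) are g₁ + h₁√s and g₂ + h₂√7.
module Coefficients (s : ℕ) (a b c d : ℚ) where
  S seven : ℚ
  S = fromℤ (+ s)
  seven = fromℤ (+ 7)

  g₁ h₁ g₂ h₂ : ℚ
  g₁ = a ℚ.* a ℚ.+ S ℚ.* (c ℚ.* c) ℚ.- seven ℚ.* (b ℚ.* b) ℚ.- seven ℚ.* S ℚ.* (d ℚ.* d)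
  h₁ = two ℚ.* (a ℚ.* c) ℚ.- two ℚ.* seven ℚ.* (b ℚ.* d)
  g₂ = a ℚ.* a ℚ.+ seven ℚ.* (b ℚ.* b) ℚ.- S ℚ.* (c ℚ.* c) ℚ.- seven ℚ.* S ℚ.* (d ℚ.* d)
  h₂ = two ℚ.* (a ℚ.* b) ℚ.- two ℚ.* S ℚ.* (c ℚ.* d)

  -- 4g₁ − 4g₂ = 2 (s C² − 7 B²) and 4g₁ + 4g₂ = 2 (A² − 7s D²) with A = 2a, …, D = 2d, and s, 7, 7s are odd.
  parity : s % 4 ≡ 3 → ∀ {A B C D G₁ G₂} → two ℚ.* a ≡ fromℤ A → two ℚ.* b ≡ fromℤ B → two ℚ.* c ≡ fromℤ C →
    two ℚ.* d ≡ fromℤ D → g₁ ≡ fromℤ G₁ → g₂ ≡ fromℤ G₂ → + 2 ℤD.∣ A ℤ.+ D × + 2 ℤD.∣ B ℤ.+ C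
  parity s%4≡3 {A} {B} {C} {D} {G₁} {G₂} 2a≡A 2b≡B 2c≡C 2d≡D g₁≡G₁ g₂≡G₂ =
    odd-combination⇒2∣+ (+ 1) (+ (7 ℕ.* s)) A D (divides (+ 0) refl) (odd (10 ℕ.+ t ℕ.* 14) 7s≡) (divides (G₁ ℤ.+ G₂) A²-7sD²≡) ,
    subst (+ 2 ℤD.∣_) (ℤP.+-comm C B) (odd-combination⇒2∣+ (+ s) (+ 7) C B (odd (1 ℕ.+ t ℕ.* 2) s≡) (divides (+ 3) refl) (divides (G₁ ℤ.- G₂) sC²-7B²≡))
    where
    open ≡-Reasoning
    t = s ℕ./ 4
    s≡3+4t : s ≡ 3 ℕ.+ t ℕ.* 4
    s≡3+4t = trans (m≡m%n+[m/n]*n s 4) (cong (ℕ._+ t ℕ.* 4) s%4≡3)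
    s≡ : s ≡ 1 ℕ.+ (1 ℕ.+ t ℕ.* 2) ℕ.* 2
    s≡ = trans s≡3+4t (ℕS.solve 1 (λ t → ℕS.con 3 ℕS.:+ t ℕS.:* ℕS.con 4 ℕS.:= ℕS.con 1 ℕS.:+ (ℕS.con 1 ℕS.:+ t ℕS.:* ℕS.con 2) ℕS.:* ℕS.con 2) refl t)
    7s≡ : 7 ℕ.* s ≡ 1 ℕ.+ (10 ℕ.+ t ℕ.* 14) ℕ.* 2
    7s≡ = trans (cong (7 ℕ.*_) s≡3+4t) (ℕS.solve 1 (λ t → ℕS.con 7 ℕS.:* (ℕS.con 3 ℕS.:+ t ℕS.:* ℕS.con 4) ℕS.:= ℕS.con 1 ℕS.:+ (ℕS.con 10 ℕS.:+ t ℕS.:* ℕS.con 14) ℕS.:* ℕS.con 2) refl t)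
    odd : ∀ k {n} → n ≡ 1 ℕ.+ k ℕ.* 2 → + 2 ℤD.∣ + n ℤ.- + 1
    odd k refl = divides (+ k) (begin
      + (1 ℕ.+ k ℕ.* 2) ℤ.- + 1       ≡⟨ cong (ℤ._- + 1) (trans (ℤP.pos-+ 1 (k ℕ.* 2)) (cong (ℤ._+_ (+ 1)) (ℤP.pos-* k 2))) ⟩
      + 1 ℤ.+ + k ℤ.* + 2 ℤ.- + 1     ≡⟨ ℤS.solve 1 (λ k → ℤS.con (+ 1) ℤS.:+ k ℤS.:* ℤS.con (+ 2) ℤS.:- ℤS.con (+ 1) ℤS.:= k ℤS.:* ℤS.con (+ 2)) refl (+ k) ⟩
      + k ℤ.* + 2                     ∎)
    sC²-7B²≡ : + s ℤ.* (C ℤ.* C) ℤ.- + 7 ℤ.* (B ℤ.* B) ≡ (G₁ ℤ.- G₂) ℤ.* + 2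
    sC²-7B²≡ = fromℤ-injective (begin
      fromℤ (+ s ℤ.* (C ℤ.* C) ℤ.- + 7 ℤ.* (B ℤ.* B))
        ≡⟨ fromℤ-⟦⟧ (evar (# 0) ⊠ (evar (# 1) ⊠ evar (# 1)) ⊞ ⊟ (econ (+ 7) ⊠ (evar (# 2) ⊠ evar (# 2)))) (+ s ∷ C ∷ B ∷ []) ⟩
      S ℚ.* (fromℤ C ℚ.* fromℤ C) ℚ.- seven ℚ.* (fromℤ B ℚ.* fromℤ B)
        ≡⟨ cong₂ (λ u v → S ℚ.* (u ℚ.* u) ℚ.- seven ℚ.* (v ℚ.* v)) 2c≡C 2b≡B ⟨
      S ℚ.* ((two ℚ.* c) ℚ.* (two ℚ.* c)) ℚ.- seven ℚ.* ((two ℚ.* b) ℚ.* (two ℚ.* b))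
        ≡⟨ ℚS.solve 6 (λ a b c d S q → S ℚS.:* ((ℚS.con two ℚS.:* c) ℚS.:* (ℚS.con two ℚS.:* c)) ℚS.:- q ℚS.:* ((ℚS.con two ℚS.:* b) ℚS.:* (ℚS.con two ℚS.:* b)) ℚS.:=
             ((a ℚS.:* a ℚS.:+ S ℚS.:* (c ℚS.:* c) ℚS.:- q ℚS.:* (b ℚS.:* b) ℚS.:- q ℚS.:* S ℚS.:* (d ℚS.:* d))
              ℚS.:- (a ℚS.:* a ℚS.:+ q ℚS.:* (b ℚS.:* b) ℚS.:- S ℚS.:* (c ℚS.:* c) ℚS.:- q ℚS.:* S ℚS.:* (d ℚS.:* d))) ℚS.:* ℚS.con two) refl a b c d S seven ⟩
      (g₁ ℚ.- g₂) ℚ.* two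
        ≡⟨ cong₂ (λ u v → (u ℚ.- v) ℚ.* two) g₁≡G₁ g₂≡G₂ ⟩
      (fromℤ G₁ ℚ.- fromℤ G₂) ℚ.* two
        ≡⟨ fromℤ-⟦⟧ ((evar (# 0) ⊞ ⊟ evar (# 1)) ⊠ econ (+ 2)) (G₁ ∷ G₂ ∷ []) ⟨
      fromℤ ((G₁ ℤ.- G₂) ℤ.* + 2) ∎)
    A²-7sD²≡ : + 1 ℤ.* (A ℤ.* A) ℤ.- + (7 ℕ.* s) ℤ.* (D ℤ.* D) ≡ (G₁ ℤ.+ G₂) ℤ.* + 2
    A²-7sD²≡ = fromℤ-injective (begin
      fromℤ (+ 1 ℤ.* (A ℤ.* A) ℤ.- + (7 ℕ.* s) ℤ.* (D ℤ.* D))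
        ≡⟨ cong (λ n → fromℤ (+ 1 ℤ.* (A ℤ.* A) ℤ.- n ℤ.* (D ℤ.* D))) (ℤP.pos-* 7 s) ⟩
      fromℤ (+ 1 ℤ.* (A ℤ.* A) ℤ.- + 7 ℤ.* + s ℤ.* (D ℤ.* D))
        ≡⟨ fromℤ-⟦⟧ (econ (+ 1) ⊠ (evar (# 1) ⊠ evar (# 1)) ⊞ ⊟ (econ (+ 7) ⊠ evar (# 0) ⊠ (evar (# 2) ⊠ evar (# 2)))) (+ s ∷ A ∷ D ∷ []) ⟩
      fromℤ (+ 1) ℚ.* (fromℤ A ℚ.* fromℤ A) ℚ.- seven ℚ.* S ℚ.* (fromℤ D ℚ.* fromℤ D)
        ≡⟨ cong₂ (λ u v → fromℤ (+ 1) ℚ.* (u ℚ.* u) ℚ.- seven ℚ.* S ℚ.* (v ℚ.* v)) 2a≡A 2d≡D ⟨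
      fromℤ (+ 1) ℚ.* ((two ℚ.* a) ℚ.* (two ℚ.* a)) ℚ.- seven ℚ.* S ℚ.* ((two ℚ.* d) ℚ.* (two ℚ.* d))
        ≡⟨ ℚS.solve 6 (λ a b c d S q → ℚS.con (fromℤ (+ 1)) ℚS.:* ((ℚS.con two ℚS.:* a) ℚS.:* (ℚS.con two ℚS.:* a)) ℚS.:- q ℚS.:* S ℚS.:* ((ℚS.con two ℚS.:* d) ℚS.:* (ℚS.con two ℚS.:* d)) ℚS.:=
             ((a ℚS.:* a ℚS.:+ S ℚS.:* (c ℚS.:* c) ℚS.:- q ℚS.:* (b ℚS.:* b) ℚS.:- q ℚS.:* S ℚS.:* (d ℚS.:* d))
              ℚS.:+ (a ℚS.:* a ℚS.:+ q ℚS.:* (b ℚS.:* b) ℚS.:- S ℚS.:* (c ℚS.:* c) ℚS.:- q ℚS.:* S ℚS.:* (d ℚS.:* d))) ℚS.:* ℚS.con two) refl a b c d S seven ⟩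
      (g₁ ℚ.+ g₂) ℚ.* two
        ≡⟨ cong₂ (λ u v → (u ℚ.+ v) ℚ.* two) g₁≡G₁ g₂≡G₂ ⟩
      (fromℤ G₁ ℚ.+ fromℤ G₂) ℚ.* two
        ≡⟨ fromℤ-⟦⟧ ((evar (# 0) ⊞ evar (# 1)) ⊠ econ (+ 2)) (G₁ ∷ G₂ ∷ []) ⟨
      fromℤ ((G₁ ℤ.+ G₂) ℤ.* + 2) ∎)

module ConjugateIdentities {s : ℕ} (x : K s) where
  open Coefficients s (K.c1 x) (K.c7 x) (K.cs x) (K.c7s x) public

  private
    ρ = env x 𝟘 𝟘 𝟘
    a = K.c1 x
    b = K.c7 x
    c = K.cs x
    d = K.c7s x
    sₑ sevenₑ twoₑ aₑ bₑ cₑ dₑ : Polynomial 18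
    sₑ = var (# 0)
    sevenₑ = var (# 1)
    twoₑ = con two
    aₑ = var (# 2)
    bₑ = var (# 3)
    cₑ = var (# 4)
    dₑ = var (# 5)
    g₁ₑ h₁ₑ g₂ₑ h₂ₑ : Polynomial 18
    g₁ₑ = aₑ :* aₑ :+ sₑ :* (cₑ :* cₑ) :- sevenₑ :* (bₑ :* bₑ) :- sevenₑ :* sₑ :* (dₑ :* dₑ)
    h₁ₑ = twoₑ :* (aₑ :* cₑ) :- twoₑ :* sevenₑ :* (bₑ :* dₑ)
    g₂ₑ = aₑ :* aₑ :+ sevenₑ :* (bₑ :* bₑ) :- sₑ :* (cₑ :* cₑ) :- sevenₑ :* sₑ :* (dₑ :* dₑ)
    h₂ₑ = twoₑ :* (aₑ :* bₑ) :- twoₑ :* sₑ :* (cₑ :* dₑ)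

  trace : x ⊕ σ₇ x ⊕ σₛ x ⊕ σ₇ₛ x ≡ rat (two ℚ.* (two ℚ.* a))
  trace = K-solve ρ (x₀ ⊕ₑ σ₇ₑ x₀ ⊕ₑ σₛₑ x₀ ⊕ₑ σ₇ₛₑ x₀) (ratₑ (twoₑ :* (twoₑ :* aₑ))) refl refl refl refl

  norm-of-trace-to-ℚ√s : (x ⊕ σ₇ x) ⊗ (σₛ x ⊕ σ₇ₛ x) ≡ rat ((two ℚ.* a) ℚ.* (two ℚ.* a) ℚ.- S ℚ.* ((two ℚ.* c) ℚ.* (two ℚ.* c)))
  norm-of-trace-to-ℚ√s = K-solve ρ ((x₀ ⊕ₑ σ₇ₑ x₀) ⊗ₑ (σₛₑ x₀ ⊕ₑ σ₇ₛₑ x₀)) (ratₑ ((twoₑ :* aₑ) :* (twoₑ :* aₑ) :- sₑ :* ((twoₑ :* cₑ) :* (twoₑ :* cₑ)))) refl refl refl refl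

  norm-of-trace-to-ℚ√7 : (x ⊕ σₛ x) ⊗ (σ₇ x ⊕ σ₇ₛ x) ≡ rat ((two ℚ.* a) ℚ.* (two ℚ.* a) ℚ.- seven ℚ.* ((two ℚ.* b) ℚ.* (two ℚ.* b)))
  norm-of-trace-to-ℚ√7 = K-solve ρ ((x₀ ⊕ₑ σₛₑ x₀) ⊗ₑ (σ₇ₑ x₀ ⊕ₑ σ₇ₛₑ x₀)) (ratₑ ((twoₑ :* aₑ) :* (twoₑ :* aₑ) :- sevenₑ :* ((twoₑ :* bₑ) :* (twoₑ :* bₑ)))) refl refl refl refl

  norm-of-trace-to-ℚ√7s : (x ⊕ σ₇ₛ x) ⊗ (σ₇ x ⊕ σₛ x) ≡ rat ((two ℚ.* a) ℚ.* (two ℚ.* a) ℚ.- (seven ℚ.* S) ℚ.* ((two ℚ.* d) ℚ.* (two ℚ.* d)))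
  norm-of-trace-to-ℚ√7s = K-solve ρ ((x₀ ⊕ₑ σ₇ₛₑ x₀) ⊗ₑ (σ₇ₑ x₀ ⊕ₑ σₛₑ x₀)) (ratₑ ((twoₑ :* aₑ) :* (twoₑ :* aₑ) :- (sevenₑ :* sₑ) :* ((twoₑ :* dₑ) :* (twoₑ :* dₑ)))) refl refl refl refl

  trace-of-norm-to-ℚ√s : x ⊗ σ₇ x ⊕ σₛ x ⊗ σ₇ₛ x ≡ rat (two ℚ.* g₁)
  trace-of-norm-to-ℚ√s = K-solve ρ (x₀ ⊗ₑ σ₇ₑ x₀ ⊕ₑ σₛₑ x₀ ⊗ₑ σ₇ₛₑ x₀) (ratₑ (twoₑ :* g₁ₑ)) refl refl refl refl

  trace-of-norm-to-ℚ√7 : x ⊗ σₛ x ⊕ σ₇ x ⊗ σ₇ₛ x ≡ rat (two ℚ.* g₂)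
  trace-of-norm-to-ℚ√7 = K-solve ρ (x₀ ⊗ₑ σₛₑ x₀ ⊕ₑ σ₇ₑ x₀ ⊗ₑ σ₇ₛₑ x₀) (ratₑ (twoₑ :* g₂ₑ)) refl refl refl refl

  norm-of-norm-to-ℚ√s : (x ⊗ σ₇ x) ⊗ (σₛ x ⊗ σ₇ₛ x) ≡ rat (g₁ ℚ.* g₁ ℚ.- S ℚ.* (h₁ ℚ.* h₁))
  norm-of-norm-to-ℚ√s = K-solve ρ ((x₀ ⊗ₑ σ₇ₑ x₀) ⊗ₑ (σₛₑ x₀ ⊗ₑ σ₇ₛₑ x₀)) (ratₑ (g₁ₑ :* g₁ₑ :- sₑ :* (h₁ₑ :* h₁ₑ))) refl refl refl refl

  norm-of-norm-to-ℚ√7 : (x ⊗ σ₇ x) ⊗ (σₛ x ⊗ σ₇ₛ x) ≡ rat (g₂ ℚ.* g₂ ℚ.- seven ℚ.* (h₂ ℚ.* h₂))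
  norm-of-norm-to-ℚ√7 = K-solve ρ ((x₀ ⊗ₑ σ₇ₑ x₀) ⊗ₑ (σₛₑ x₀ ⊗ₑ σ₇ₛₑ x₀)) (ratₑ (g₂ₑ :* g₂ₑ :- sevenₑ :* (h₂ₑ :* h₂ₑ))) refl refl refl refl

module _ {s : ℕ} (s%4≡3 : s % 4 ≡ 3) (sf : SquareFree s) (7∤s : ¬ 7 ℕD.∣ s) {x : K s} (x-int : IsAlgInt x) where
  open ConjugateIdentities x

  private
    a = K.c1 x
    b = K.c7 x
    c = K.cs x
    d = K.c7s x

    rational : ∀ {u} q → ℤ[conjugates] x u → u ≡ rat q → Integral q
    rational q u∈ u≡q = ℤ[conjugates]-rat⇒Integral x-int q (subst (ℤ[conjugates] x) u≡q u∈)

    infixl 7 _⊗ₛ_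
    _⊗ₛ_ : ∀ {u v} → ℤ[conjugates] x u → ℤ[conjugates] x v → ℤ[conjugates] x (u ⊗ v)
    _⊗ₛ_ = Span-⊗ Monomial-⊗

    4a-Integral : Integral (two ℚ.* (two ℚ.* a))
    4a-Integral = rational _ (y₀∈Span ⊕ₛ y₁∈Span ⊕ₛ y₂∈Span ⊕ₛ y₃∈Span) trace

    2a×2c-Integral : Integral (two ℚ.* a) × Integral (two ℚ.* c)
    2a×2c-Integral = trace-norm-integral⇒integral s s%4≡3 sf (two ℚ.* a) (two ℚ.* c) 4a-Integral
      (rational _ ((y₀∈Span ⊕ₛ y₁∈Span) ⊗ₛ (y₂∈Span ⊕ₛ y₃∈Span)) norm-of-trace-to-ℚ√s)

    2b-Integral : Integral (two ℚ.* b)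
    2b-Integral = proj₂ (trace-norm-integral⇒integral 7 refl 7-squarefree (two ℚ.* a) (two ℚ.* b) 4a-Integral
      (rational _ ((y₀∈Span ⊕ₛ y₂∈Span) ⊗ₛ (y₁∈Span ⊕ₛ y₃∈Span)) norm-of-trace-to-ℚ√7))

    2d-Integral : Integral (two ℚ.* d)
    2d-Integral = squarefree-multiple⇒Integral (7 ℕ.* s) (7*s-squarefree s sf 7∤s) (two ℚ.* d)
      (subst Integral (sym eq) (Integral-+ (Integral-* (proj₁ 2a×2c-Integral) (proj₁ 2a×2c-Integral))
        (Integral-neg (rational _ ((y₀∈Span ⊕ₛ y₃∈Span) ⊗ₛ (y₁∈Span ⊕ₛ y₂∈Span)) norm-of-trace-to-ℚ√7s))))
      where
      eq : fromℤ (+ (7 ℕ.* s)) ℚ.* ((two ℚ.* d) ℚ.* (two ℚ.* d)) ≡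
           (two ℚ.* a) ℚ.* (two ℚ.* a) ℚ.+ ℚ.- ((two ℚ.* a) ℚ.* (two ℚ.* a) ℚ.- (seven ℚ.* S) ℚ.* ((two ℚ.* d) ℚ.* (two ℚ.* d)))
      eq = trans (cong (λ n → fromℤ n ℚ.* ((two ℚ.* d) ℚ.* (two ℚ.* d))) (ℤP.pos-* 7 s))
        (trans (cong (ℚ._* ((two ℚ.* d) ℚ.* (two ℚ.* d))) (fromℤ-* (+ 7) (+ s)))
          (ℚS.solve 3 (λ a d q → q ℚS.:* ((ℚS.con two ℚS.:* d) ℚS.:* (ℚS.con two ℚS.:* d)) ℚS.:=
             (ℚS.con two ℚS.:* a) ℚS.:* (ℚS.con two ℚS.:* a) ℚS.:+ ℚS.:- ((ℚS.con two ℚS.:* a) ℚS.:* (ℚS.con two ℚS.:* a) ℚS.:- q ℚS.:* ((ℚS.con two ℚS.:* d) ℚS.:* (ℚS.con two ℚS.:* d)))) refl a d (seven ℚ.* S)))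

    g₁-Integral : Integral g₁
    g₁-Integral = proj₁ (trace-norm-integral⇒integral s s%4≡3 sf g₁ h₁
      (rational _ (y₀∈Span ⊗ₛ y₁∈Span ⊕ₛ y₂∈Span ⊗ₛ y₃∈Span) trace-of-norm-to-ℚ√s)
      (rational _ ((y₀∈Span ⊗ₛ y₁∈Span) ⊗ₛ (y₂∈Span ⊗ₛ y₃∈Span)) norm-of-norm-to-ℚ√s))

    g₂-Integral : Integral g₂
    g₂-Integral = proj₁ (trace-norm-integral⇒integral 7 refl 7-squarefree g₂ h₂
      (rational _ (y₀∈Span ⊗ₛ y₂∈Span ⊕ₛ y₁∈Span ⊗ₛ y₃∈Span) trace-of-norm-to-ℚ√7)
      (rational _ ((y₀∈Span ⊗ₛ y₁∈Span) ⊗ₛ (y₂∈Span ⊗ₛ y₃∈Span)) norm-of-norm-to-ℚ√7))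

    half : ∀ q Q → two ℚ.* q ≡ fromℤ Q → q ≡ fromℤ Q ℚ.* ½
    half q Q 2q≡Q = trans (ℚS.solve 1 (λ q → q ℚS.:= (ℚS.con two ℚS.:* q) ℚS.:* ℚS.con ½) refl q) (cong (ℚ._* ½) 2q≡Q)

  IsAlgInt⇒IntegerForm : IntegerForm x
  IsAlgInt⇒IntegerForm = integerForm A B C D
    (⟨⟩-cong (half a A 2a≡A) (half b B 2b≡B) (half c C 2c≡C) (half d D 2d≡D))
    (proj₁ 2∣A+D×2∣B+C) (proj₂ 2∣A+D×2∣B+C)
    where
    A = proj₁ (proj₁ 2a×2c-Integral)
    2a≡A = proj₂ (proj₁ 2a×2c-Integral)
    B = proj₁ 2b-Integral
    2b≡B = proj₂ 2b-Integral
    C = proj₁ (proj₂ 2a×2c-Integral)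
    2c≡C = proj₂ (proj₂ 2a×2c-Integral)
    D = proj₁ 2d-Integral
    2d≡D = proj₂ 2d-Integral
    2∣A+D×2∣B+C = parity s%4≡3 {A} {B} {C} {D} {proj₁ g₁-Integral} {proj₁ g₂-Integral} 2a≡A 2b≡B 2c≡C 2d≡D (proj₂ g₁-Integral) (proj₂ g₂-Integral)

Quadruple : Set
Quadruple = ℤ × ℤ × ℤ × ℤ

Admissible : Quadruple → Set
Admissible (A , B , C , D) = + 2 ℤD.∣ A ℤ.+ D × + 2 ℤD.∣ B ℤ.+ C

-- ((A + B√7 + C√s + D√7s)/2)² = (sq₁ + sq₇ √7 + sqₛ √s + sq₇ₛ √7s)/4 · (1, 2, 2, 2).
sq₁ sq₇ : ℕ → Quadruple → ℤ
sq₁ s (A , B , C , D) = A ℤ.* A ℤ.+ + 7 ℤ.* (B ℤ.* B) ℤ.+ + s ℤ.* (C ℤ.* C) ℤ.+ (+ 7 ℤ.* + s) ℤ.* (D ℤ.* D)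
sq₇ s (A , B , C , D) = A ℤ.* B ℤ.+ + s ℤ.* (C ℤ.* D)

sqₛ sq₇ₛ : Quadruple → ℤ
sqₛ (A , B , C , D) = A ℤ.* C ℤ.+ + 7 ℤ.* (B ℤ.* D)
sq₇ₛ (A , B , C , D) = A ℤ.* D ℤ.+ B ℤ.* C

sumℤ : (Quadruple → ℤ) → List Quadruple → ℤ
sumℤ f [] = + 0
sumℤ f (t ∷ ts) = f t ℤ.+ sumℤ f ts

¼ : ℚ
¼ = + 1 / 4

module _ {s : ℕ} where

  quarters : ℤ → ℤ → ℤ → ℤ → K s
  quarters a b c d = ⟨ fromℤ a ℚ.* ¼ , fromℤ b ℚ.* ½ , fromℤ c ℚ.* ½ , fromℤ d ℚ.* ½ ⟩

  halves : Quadruple → K s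
  halves (A , B , C , D) = ⟨ fromℤ A ℚ.* ½ , fromℤ B ℚ.* ½ , fromℤ C ℚ.* ½ , fromℤ D ℚ.* ½ ⟩

  sum-of-quarters : List Quadruple → K s
  sum-of-quarters ts = quarters (sumℤ (sq₁ s) ts) (sumℤ (sq₇ s) ts) (sumℤ sqₛ ts) (sumℤ sq₇ₛ ts)

  halves-square : ∀ t → halves t ⊗ halves t ≡ quarters (sq₁ s t) (sq₇ s t) (sqₛ t) (sq₇ₛ t)
  halves-square (A , B , C , D) = ⟨⟩-cong
    (trans (ℚS.solve 6 (λ a b c d S Q → (a ℚS.:* h) ℚS.:* (a ℚS.:* h) ℚS.:+ Q ℚS.:* (b ℚS.:* h) ℚS.:* (b ℚS.:* h) ℚS.:+ S ℚS.:* (c ℚS.:* h) ℚS.:* (c ℚS.:* h) ℚS.:+ Q ℚS.:* S ℚS.:* (d ℚS.:* h) ℚS.:* (d ℚS.:* h)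
        ℚS.:= (a ℚS.:* a ℚS.:+ Q ℚS.:* (b ℚS.:* b) ℚS.:+ S ℚS.:* (c ℚS.:* c) ℚS.:+ (Q ℚS.:* S) ℚS.:* (d ℚS.:* d)) ℚS.:* ℚS.con ¼) refl (fromℤ A) (fromℤ B) (fromℤ C) (fromℤ D) (fromℤ (+ s)) (fromℤ (+ 7)))
       (cong (ℚ._* ¼) (sym (fromℤ-⟦⟧ (a ⊠ a ⊞ econ (+ 7) ⊠ (b ⊠ b) ⊞ S ⊠ (c ⊠ c) ⊞ (econ (+ 7) ⊠ S) ⊠ (d ⊠ d)) ρ))))
    (trans (ℚS.solve 6 (λ a b c d S Q → (a ℚS.:* h) ℚS.:* (b ℚS.:* h) ℚS.:+ (b ℚS.:* h) ℚS.:* (a ℚS.:* h) ℚS.:+ S ℚS.:* ((c ℚS.:* h) ℚS.:* (d ℚS.:* h) ℚS.:+ (d ℚS.:* h) ℚS.:* (c ℚS.:* h))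
        ℚS.:= (a ℚS.:* b ℚS.:+ S ℚS.:* (c ℚS.:* d)) ℚS.:* h) refl (fromℤ A) (fromℤ B) (fromℤ C) (fromℤ D) (fromℤ (+ s)) (fromℤ (+ 7)))
       (cong (ℚ._* ½) (sym (fromℤ-⟦⟧ (a ⊠ b ⊞ S ⊠ (c ⊠ d)) ρ))))
    (trans (ℚS.solve 6 (λ a b c d S Q → (a ℚS.:* h) ℚS.:* (c ℚS.:* h) ℚS.:+ (c ℚS.:* h) ℚS.:* (a ℚS.:* h) ℚS.:+ Q ℚS.:* ((b ℚS.:* h) ℚS.:* (d ℚS.:* h) ℚS.:+ (d ℚS.:* h) ℚS.:* (b ℚS.:* h))
        ℚS.:= (a ℚS.:* c ℚS.:+ Q ℚS.:* (b ℚS.:* d)) ℚS.:* h) refl (fromℤ A) (fromℤ B) (fromℤ C) (fromℤ D) (fromℤ (+ s)) (fromℤ (+ 7)))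
       (cong (ℚ._* ½) (sym (fromℤ-⟦⟧ (a ⊠ c ⊞ econ (+ 7) ⊠ (b ⊠ d)) ρ))))
    (trans (ℚS.solve 6 (λ a b c d S Q → (a ℚS.:* h) ℚS.:* (d ℚS.:* h) ℚS.:+ (d ℚS.:* h) ℚS.:* (a ℚS.:* h) ℚS.:+ (b ℚS.:* h) ℚS.:* (c ℚS.:* h) ℚS.:+ (c ℚS.:* h) ℚS.:* (b ℚS.:* h)
        ℚS.:= (a ℚS.:* d ℚS.:+ b ℚS.:* c) ℚS.:* h) refl (fromℤ A) (fromℤ B) (fromℤ C) (fromℤ D) (fromℤ (+ s)) (fromℤ (+ 7)))
       (cong (ℚ._* ½) (sym (fromℤ-⟦⟧ (a ⊠ d ⊞ b ⊠ c) ρ))))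
    where
    h = ℚS.con ½
    a = evar (# 0)
    b = evar (# 1)
    c = evar (# 2)
    d = evar (# 3)
    S = evar (# 4)
    ρ = A ∷ B ∷ C ∷ D ∷ + s ∷ []

  quarters-⊕ : ∀ a b c d a′ b′ c′ d′ → quarters a b c d ⊕ quarters a′ b′ c′ d′ ≡ quarters (a ℤ.+ a′) (b ℤ.+ b′) (c ℤ.+ c′) (d ℤ.+ d′)
  quarters-⊕ a b c d a′ b′ c′ d′ = ⟨⟩-cong (+-* ¼ a a′) (+-* ½ b b′) (+-* ½ c c′) (+-* ½ d d′)
    where
    +-* : ∀ k u v → fromℤ u ℚ.* k ℚ.+ fromℤ v ℚ.* k ≡ fromℤ (u ℤ.+ v) ℚ.* k
    +-* k u v = trans (sym (ℚP.*-distribʳ-+ k (fromℤ u) (fromℤ v))) (cong (ℚ._* k) (sym (fromℤ-+ u v)))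

  quarters-injective : ∀ {a b c d a′ b′ c′ d′} → quarters a b c d ≡ quarters a′ b′ c′ d′ → a ≡ a′ × b ≡ b′ × c ≡ c′ × d ≡ d′
  quarters-injective e = cancel ¼ (+ 4) refl (cong K.c1 e) , cancel ½ (+ 2) refl (cong K.c7 e) ,
                         cancel ½ (+ 2) refl (cong K.cs e) , cancel ½ (+ 2) refl (cong K.c7s e)
    where
    cancel : ∀ k m {u v} → k ℚ.* fromℤ m ≡ 1ℚ → fromℤ u ℚ.* k ≡ fromℤ v ℚ.* k → u ≡ v
    cancel k m {u} {v} km≡1 e = fromℤ-injective (begin
      fromℤ u                       ≡⟨ ℚP.*-identityʳ (fromℤ u) ⟨
      fromℤ u ℚ.* 1ℚ                ≡⟨ cong (fromℤ u ℚ.*_) km≡1 ⟨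
      fromℤ u ℚ.* (k ℚ.* fromℤ m)   ≡⟨ ℚP.*-assoc (fromℤ u) k (fromℤ m) ⟨
      (fromℤ u ℚ.* k) ℚ.* fromℤ m   ≡⟨ cong (ℚ._* fromℤ m) e ⟩
      (fromℤ v ℚ.* k) ℚ.* fromℤ m   ≡⟨ ℚP.*-assoc (fromℤ v) k (fromℤ m) ⟩
      fromℤ v ℚ.* (k ℚ.* fromℤ m)   ≡⟨ cong (fromℤ v ℚ.*_) km≡1 ⟩
      fromℤ v ℚ.* 1ℚ                ≡⟨ ℚP.*-identityʳ (fromℤ v) ⟩
      fromℤ v                       ∎)
      where open ≡-Reasoning

  sumSq-quarters : s % 4 ≡ 3 → SquareFree s → ¬ 7 ℕD.∣ s → ∀ (xs : List (K s)) → All IsAlgInt xs →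
    Σ (List Quadruple) λ ts → length ts ≡ length xs × All Admissible ts × sumSq xs ≡ sum-of-quarters ts
  sumSq-quarters s%4≡3 sf 7∤s [] [] = [] , refl , [] , refl
  sumSq-quarters s%4≡3 sf 7∤s (x ∷ xs) (x-int ∷ xs-int) =
    cons (IsAlgInt⇒IntegerForm s%4≡3 sf 7∤s x-int) (sumSq-quarters s%4≡3 sf 7∤s xs xs-int)
    where
    open ≡-Reasoning
    cons : IntegerForm x → (Σ (List Quadruple) λ ts → length ts ≡ length xs × All Admissible ts × sumSq xs ≡ sum-of-quarters ts) →
      Σ (List Quadruple) λ ts → length ts ≡ length (x ∷ xs) × All Admissible ts × sumSq (x ∷ xs) ≡ sum-of-quarters ts
    cons (integerForm A B C D x≡ 2∣A+D 2∣B+C) (ts , length≡ , admissible , sumSq≡) =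
      t ∷ ts , cong suc length≡ , (2∣A+D , 2∣B+C) ∷ admissible , (begin
        x ⊗ x ⊕ sumSq xs                          ≡⟨ cong₂ (λ u v → u ⊗ u ⊕ v) x≡ sumSq≡ ⟩
        halves t ⊗ halves t ⊕ sum-of-quarters ts  ≡⟨ cong (_⊕ sum-of-quarters ts) (halves-square t) ⟩
        quarters (sq₁ s t) (sq₇ s t) (sqₛ t) (sq₇ₛ t) ⊕ sum-of-quarters ts
          ≡⟨ quarters-⊕ (sq₁ s t) (sq₇ s t) (sqₛ t) (sq₇ₛ t) (sumℤ (sq₁ s) ts) (sumℤ (sq₇ s) ts) (sumℤ sqₛ ts) (sumℤ sq₇ₛ ts) ⟩
        sum-of-quarters (t ∷ ts)                  ∎)
      where
      t = (A , B , C , D)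

-- Meant to be proved by refl: that equation is checked far faster than T (refutes P? xs).
refutes : ∀ {A : Set} {P : A → Set} → Decidable P → List A → Bool
refutes P? xs = and (map (λ x → not (does (P? x))) xs)

refutes-sound : ∀ {A : Set} {P : A → Set} (P? : Decidable P) xs → refutes P? xs ≡ true → ∀ {x} → x ∈ xs → ¬ P x
refutes-sound P? xs check x∈xs = refuted (P? _) (All.lookup (AllP.all⁺ (λ x → not (does (P? x))) xs (subst T (sym check) tt)) x∈xs)
  where
  refuted : ∀ {Q : Set} (Q? : Dec Q) → T (not (does Q?)) → ¬ Q
  refuted (no ¬q) _ = ¬q

range : ℕ → List ℤ
range n = applyUpTo +_ (suc n) ++ applyUpTo -[1+_] n

∈-range : ∀ {n} z → ℤ.∣ z ∣ ℕ.≤ n → z ∈ range n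
∈-range (+ i) i≤n = ∈-++⁺ˡ (∈-applyUpTo⁺ +_ (s≤s i≤n))
∈-range {n} -[1+ i ] i<n = ∈-++⁺ʳ (applyUpTo +_ (suc n)) (∈-applyUpTo⁺ -[1+_] i<n)

data Comparison : Set where
  less equal greater : Comparison

compareℕ : ℕ → ℕ → Comparison
compareℕ m n = if m ℕ.<ᵇ n then less else if n ℕ.<ᵇ m then greater else equal

compareℕ-equal : ∀ m n → compareℕ m n ≡ equal → m ≡ n
compareℕ-equal m n eq with m ℕ.<ᵇ n in m<n | n ℕ.<ᵇ m in n<m
compareℕ-equal m n refl | false | false = ℕP.≤-antisym (ℕP.≮⇒≥ (not< n<m)) (ℕP.≮⇒≥ (not< m<n))
  where
  not< : ∀ {a b} → (a ℕ.<ᵇ b) ≡ false → ¬ a ℕ.< b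
  not< {a} {b} a≮b a<b with ℕP.<⇒<ᵇ a<b
  ... | t rewrite a≮b = t

compareℤ : ℤ → ℤ → Comparison
compareℤ (+ m) (+ n) = compareℕ m n
compareℤ (+ _) -[1+ _ ] = greater
compareℤ -[1+ _ ] (+ _) = less
compareℤ -[1+ m ] -[1+ n ] = compareℕ n m

compareℤ-equal : ∀ x y → compareℤ x y ≡ equal → x ≡ y
compareℤ-equal (+ m) (+ n) eq = cong +_ (compareℕ-equal m n eq)
compareℤ-equal -[1+ m ] -[1+ n ] eq = cong -[1+_] (sym (compareℕ-equal n m eq))

compareᵛ : ∀ {n} → Vec ℤ n → Vec ℤ n → Comparison
compareᵛ [] [] = equal
compareᵛ (x ∷ xs) (y ∷ ys) with compareℤ x y
... | less = less
... | equal = compareᵛ xs ys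
... | greater = greater

compareᵛ-equal : ∀ {n} (u v : Vec ℤ n) → compareᵛ u v ≡ equal → u ≡ v
compareᵛ-equal [] [] _ = refl
compareᵛ-equal (x ∷ xs) (y ∷ ys) eq with compareℤ x y in x≟y
... | equal = cong₂ _∷_ (compareℤ-equal x y x≟y) (compareᵛ-equal xs ys eq)

-- Merging of lexicographically sorted lists, keeping one copy of common elements. Sortedness
-- only makes the removal of duplicates effective; membership is preserved regardless.
mutual
  merge : ∀ {n} → List (Vec ℤ n) → List (Vec ℤ n) → List (Vec ℤ n)
  merge [] ys = ys
  merge (x ∷ xs) ys = merge-into x xs ys

  merge-into : ∀ {n} → Vec ℤ n → List (Vec ℤ n) → List (Vec ℤ n) → List (Vec ℤ n)
  merge-into x xs [] = x ∷ xs
  merge-into x xs (y ∷ ys) = merge-step (compareᵛ x y) x xs y ys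

  merge-step : ∀ {n} → Comparison → Vec ℤ n → List (Vec ℤ n) → Vec ℤ n → List (Vec ℤ n) → List (Vec ℤ n)
  merge-step less x xs y ys = x ∷ merge xs (y ∷ ys)
  merge-step equal x xs y ys = x ∷ merge xs ys
  merge-step greater x xs y ys = y ∷ merge-into x xs ys

mutual
  ∈-mergeˡ : ∀ {n} {z : Vec ℤ n} xs ys → z ∈ xs → z ∈ merge xs ys
  ∈-mergeˡ (x ∷ xs) ys (here refl) = ∈-merge-into-head x xs ys
  ∈-mergeˡ (x ∷ xs) ys (there z∈) = ∈-merge-intoˡ x xs ys z∈

  ∈-mergeʳ : ∀ {n} {z : Vec ℤ n} xs ys → z ∈ ys → z ∈ merge xs ys
  ∈-mergeʳ [] ys z∈ = z∈
  ∈-mergeʳ (x ∷ xs) ys z∈ = ∈-merge-intoʳ x xs ys z∈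

  ∈-merge-into-head : ∀ {n} (x : Vec ℤ n) xs ys → x ∈ merge-into x xs ys
  ∈-merge-into-head x xs [] = here refl
  ∈-merge-into-head x xs (y ∷ ys) with compareᵛ x y
  ... | less = here refl
  ... | equal = here refl
  ... | greater = there (∈-merge-into-head x xs ys)

  ∈-merge-intoˡ : ∀ {n} {z : Vec ℤ n} x xs ys → z ∈ xs → z ∈ merge-into x xs ys
  ∈-merge-intoˡ x xs [] z∈ = there z∈
  ∈-merge-intoˡ x xs (y ∷ ys) z∈ with compareᵛ x y
  ... | less = there (∈-mergeˡ xs (y ∷ ys) z∈)
  ... | equal = there (∈-mergeˡ xs ys z∈)
  ... | greater = there (∈-merge-intoˡ x xs ys z∈)

  ∈-merge-intoʳ : ∀ {n} {z : Vec ℤ n} x xs ys → z ∈ ys → z ∈ merge-into x xs ys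
  ∈-merge-intoʳ x xs (y ∷ ys) z∈ with compareᵛ x y in x≟y
  ∈-merge-intoʳ x xs (y ∷ ys) (here refl) | less = there (∈-mergeʳ xs (y ∷ ys) (here refl))
  ∈-merge-intoʳ x xs (y ∷ ys) (there z∈) | less = there (∈-mergeʳ xs (y ∷ ys) (there z∈))
  ∈-merge-intoʳ x xs (y ∷ ys) (here refl) | equal = here (sym (compareᵛ-equal x y x≟y))
  ∈-merge-intoʳ x xs (y ∷ ys) (there z∈) | equal = there (∈-mergeʳ xs ys z∈)
  ∈-merge-intoʳ x xs (y ∷ ys) (here refl) | greater = here refl
  ∈-merge-intoʳ x xs (y ∷ ys) (there z∈) | greater = there (∈-merge-intoʳ x xs ys z∈)

-- The sums of k weights of candidates all of whose partial sums satisfy Keep, listed by dynamic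
-- programming.
module Reachable {A : Set} {n : ℕ} (weight : A → Vec ℤ n) {Keep : Vec ℤ n → Set} (keep? : Decidable Keep) (candidates : List A) where

  -- weight t is passed as an argument so that it is shared; in a section it would be recomputed
  -- for every state.
  extend : List (Vec ℤ n) → A → List (Vec ℤ n)
  extend R t = filter keep? (map (Vec.zipWith ℤ._+_ (weight t)) R)

  step : List (Vec ℤ n) → List (Vec ℤ n)
  step R = foldr (merge ∘ extend R) [] candidates

  reachable : ℕ → List (Vec ℤ n)
  reachable zero = Vec.replicate n (+ 0) ∷ []
  reachable (suc k) = step (reachable k)

  weight-sum : List A → Vec ℤ n
  weight-sum [] = Vec.replicate n (+ 0)
  weight-sum (t ∷ ts) = Vec.zipWith ℤ._+_ (weight t) (weight-sum ts)

  Kept : List A → Set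
  Kept [] = ⊤
  Kept (t ∷ ts) = Keep (weight-sum (t ∷ ts)) × Kept ts

  ∈-step : ∀ R {t z} → t ∈ candidates → z ∈ extend R t → z ∈ step R
  ∈-step R = go candidates
    where
    go : ∀ cs {t z} → t ∈ cs → z ∈ extend R t → z ∈ foldr (merge ∘ extend R) [] cs
    go (c ∷ cs) (here refl) z∈ = ∈-mergeˡ (extend R c) _ z∈
    go (c ∷ cs) (there t∈) z∈ = ∈-mergeʳ (extend R c) _ (go cs t∈ z∈)

  weight-sum-reachable : ∀ ts → All (_∈ candidates) ts → Kept ts → weight-sum ts ∈ reachable (length ts)
  weight-sum-reachable [] [] tt = here refl
  weight-sum-reachable (t ∷ ts) (t∈ ∷ ts∈) (kept , ts-kept) =
    ∈-step (reachable (length ts)) t∈ (∈-filter⁺ keep? (∈-map⁺ (Vec.zipWith ℤ._+_ (weight t)) (weight-sum-reachable ts ts∈ ts-kept)) kept)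

ν₁ ν₂ : Quadruple → ℕ
ν₁ (A , B , C , D) = ℤ.∣ A ∣ ℕ.* ℤ.∣ A ∣ ℕ.+ 7 ℕ.* (ℤ.∣ B ∣ ℕ.* ℤ.∣ B ∣)
ν₂ (A , B , C , D) = ℤ.∣ C ∣ ℕ.* ℤ.∣ C ∣ ℕ.+ 7 ℕ.* (ℤ.∣ D ∣ ℕ.* ℤ.∣ D ∣)

Φ : ℕ → Quadruple → ℕ
Φ s t = ν₁ t ℕ.+ s ℕ.* ν₂ t

+-7*-pos : ∀ a b → + a ℤ.+ + 7 ℤ.* + b ≡ + (a ℕ.+ 7 ℕ.* b)
+-7*-pos a b = sym (trans (ℤP.pos-+ a (7 ℕ.* b)) (cong (ℤ._+_ (+ a)) (ℤP.pos-* 7 b)))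

squares-≡ : ∀ X Y → X ℤ.* X ℤ.+ + 7 ℤ.* (Y ℤ.* Y) ≡ + (ℤ.∣ X ∣ ℕ.* ℤ.∣ X ∣ ℕ.+ 7 ℕ.* (ℤ.∣ Y ∣ ℕ.* ℤ.∣ Y ∣))
squares-≡ X Y = trans (cong₂ (λ x y → x ℤ.+ + 7 ℤ.* y) (i*i≡+∣i∣*∣i∣ X) (i*i≡+∣i∣*∣i∣ Y)) (+-7*-pos (ℤ.∣ X ∣ ℕ.* ℤ.∣ X ∣) (ℤ.∣ Y ∣ ℕ.* ℤ.∣ Y ∣))

sq₁≡Φ : ∀ s t → sq₁ s t ≡ + Φ s t
sq₁≡Φ s t@(A , B , C , D) = begin
  A ℤ.* A ℤ.+ + 7 ℤ.* (B ℤ.* B) ℤ.+ + s ℤ.* (C ℤ.* C) ℤ.+ (+ 7 ℤ.* + s) ℤ.* (D ℤ.* D)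
    ≡⟨ ℤS.solve 5 (λ A B C D S → A ℤS.:* A ℤS.:+ ℤS.con (+ 7) ℤS.:* (B ℤS.:* B) ℤS.:+ S ℤS.:* (C ℤS.:* C) ℤS.:+ (ℤS.con (+ 7) ℤS.:* S) ℤS.:* (D ℤS.:* D)
         ℤS.:= (A ℤS.:* A ℤS.:+ ℤS.con (+ 7) ℤS.:* (B ℤS.:* B)) ℤS.:+ S ℤS.:* (C ℤS.:* C ℤS.:+ ℤS.con (+ 7) ℤS.:* (D ℤS.:* D))) refl A B C D (+ s) ⟩
  (A ℤ.* A ℤ.+ + 7 ℤ.* (B ℤ.* B)) ℤ.+ + s ℤ.* (C ℤ.* C ℤ.+ + 7 ℤ.* (D ℤ.* D)) ≡⟨ cong₂ (λ x y → x ℤ.+ + s ℤ.* y) (squares-≡ A B) (squares-≡ C D) ⟩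
  + ν₁ t ℤ.+ + s ℤ.* + ν₂ t                                                    ≡⟨ cong (ℤ._+_ (+ ν₁ t)) (ℤP.pos-* s (ν₂ t)) ⟨
  + ν₁ t ℤ.+ + (s ℕ.* ν₂ t)                                                    ≡⟨ ℤP.pos-+ (ν₁ t) (s ℕ.* ν₂ t) ⟨
  + Φ s t                                                                      ∎
  where open ≡-Reasoning

sumℤ-sq₁ : ∀ s ts → sumℤ (sq₁ s) ts ≡ + sum (map (Φ s) ts)
sumℤ-sq₁ s [] = refl
sumℤ-sq₁ s (t ∷ ts) = trans (cong₂ ℤ._+_ (sq₁≡Φ s t) (sumℤ-sq₁ s ts)) (sym (ℤP.pos-+ (Φ s t) _))

sum-Φ : ∀ s ts → sum (map (Φ s) ts) ≡ sum (map ν₁ ts) ℕ.+ s ℕ.* sum (map ν₂ ts)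
sum-Φ s [] = sym (cong (0 ℕ.+_) (ℕP.*-zeroʳ s))
sum-Φ s (t ∷ ts) = trans (cong (Φ s t ℕ.+_) (sum-Φ s ts))
  (ℕS.solve 5 (λ a b A B s → (a ℕS.:+ s ℕS.:* b) ℕS.:+ (A ℕS.:+ s ℕS.:* B) ℕS.:= (a ℕS.:+ A) ℕS.:+ s ℕS.:* (b ℕS.:+ B)) refl (ν₁ t) (ν₂ t) (sum (map ν₁ ts)) (sum (map ν₂ ts)) s)

square-bound : ∀ c a K n → c ℕ.* (a ℕ.* a) ℕ.≤ K → K ℕ.< c ℕ.* (suc n ℕ.* suc n) → a ℕ.≤ n
square-bound c a K n ca²≤K K<c[n+1]² with a ℕ.≤? n
... | yes a≤n = a≤n
... | no a≰n = ⊥-elim (ℕP.<⇒≱ K<c[n+1]² (ℕP.≤-trans (ℕP.*-monoʳ-≤ c (ℕP.*-mono-≤ (ℕP.≰⇒> a≰n) (ℕP.≰⇒> a≰n))) ca²≤K))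

quadruples : ℕ → ℕ → ℕ → ℕ → List Quadruple
quadruples a b c d = cartesianProduct (range a) (cartesianProduct (range b) (cartesianProduct (range c) (range d)))

∈-quadruples : ∀ {a b c d} A B C D → ℤ.∣ A ∣ ℕ.≤ a → ℤ.∣ B ∣ ℕ.≤ b → ℤ.∣ C ∣ ℕ.≤ c → ℤ.∣ D ∣ ℕ.≤ d →
  (A , B , C , D) ∈ quadruples a b c d
∈-quadruples A B C D A≤ B≤ C≤ D≤ = ∈-cartesianProduct⁺ (∈-range A A≤) (∈-cartesianProduct⁺ (∈-range B B≤) (∈-cartesianProduct⁺ (∈-range C C≤) (∈-range D D≤)))

admissible? : Decidable Admissible
admissible? (A , B , C , D) = (+ 2 ℤD.∣? (A ℤ.+ D)) ×-dec (+ 2 ℤD.∣? (B ℤ.+ C))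

module Case-s≡11 where

  Candidate : Quadruple → Set
  Candidate t = Admissible t × Φ 11 t ℕ.≤ 96

  candidate? : Decidable Candidate
  candidate? t = admissible? t ×-dec (Φ 11 t ℕ.≤? 96)

  candidates : List Quadruple
  candidates = filter candidate? (quadruples 9 3 2 1)

  ∈-candidates : ∀ t → Candidate t → t ∈ candidates
  ∈-candidates t@(A , B , C , D) candidate@(_ , Φ≤96) = ∈-filter⁺ candidate? (∈-quadruples A B C D
      (square-bound 1 ℤ.∣ A ∣ 96 9 (subst (ℕ._≤ 96) (sym (ℕP.*-identityˡ _)) (ℕP.m+n≤o⇒m≤o _ ν₁≤96)) (from-yes (96 ℕ.<? 100)))
      (square-bound 7 ℤ.∣ B ∣ 96 3 (ℕP.m+n≤o⇒n≤o (ℤ.∣ A ∣ ℕ.* ℤ.∣ A ∣) ν₁≤96) (from-yes (96 ℕ.<? 112)))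
      (square-bound 11 ℤ.∣ C ∣ 96 2 (ℕP.m+n≤o⇒m≤o _ 11ν₂≤96) (from-yes (96 ℕ.<? 99)))
      (square-bound 77 ℤ.∣ D ∣ 96 1 (subst (ℕ._≤ 96) (sym (ℕP.*-assoc 11 7 (ℤ.∣ D ∣ ℕ.* ℤ.∣ D ∣))) (ℕP.m+n≤o⇒n≤o (11 ℕ.* (ℤ.∣ C ∣ ℕ.* ℤ.∣ C ∣)) 11ν₂≤96)) (from-yes (96 ℕ.<? 308))))
    candidate
    where
    ν₁≤96 : ν₁ t ℕ.≤ 96
    ν₁≤96 = ℕP.m+n≤o⇒m≤o (ν₁ t) Φ≤96
    11ν₂≤96 : 11 ℕ.* (ℤ.∣ C ∣ ℕ.* ℤ.∣ C ∣) ℕ.+ 11 ℕ.* (7 ℕ.* (ℤ.∣ D ∣ ℕ.* ℤ.∣ D ∣)) ℕ.≤ 96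
    11ν₂≤96 = subst (ℕ._≤ 96) (ℕP.*-distribˡ-+ 11 (ℤ.∣ C ∣ ℕ.* ℤ.∣ C ∣) (7 ℕ.* (ℤ.∣ D ∣ ℕ.* ℤ.∣ D ∣))) (ℕP.m+n≤o⇒n≤o (ν₁ t) Φ≤96)

  weight : Quadruple → Vec ℤ 4
  weight t = + Φ 11 t ∷ sq₇ 11 t ∷ sqₛ t ∷ sq₇ₛ t ∷ []

  Keep : Vec ℤ 4 → Set
  Keep v = ℤ.∣ Vec.head v ∣ ℕ.≤ 96

  open Reachable weight {Keep} (λ v → ℤ.∣ Vec.head v ∣ ℕ.≤? 96) candidates

  target : Vec ℤ 4
  target = + 96 ∷ + 10 ∷ + 2 ∷ + 2 ∷ []

  target≟ : Decidable (target ≡_)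
  target≟ = VecP.≡-dec ℤP._≟_ target

  -- A function of k, to be applied to the neutral length of a list below: unifying with reachable 5
  -- itself would rerun the search during type checking.
  target-absent : ℕ → Bool
  target-absent k = refutes target≟ (reachable k)

  target-absent-5 : target-absent 5 ≡ true
  target-absent-5 = refl

  weight-sum≡ : ∀ ts → weight-sum ts ≡ (+ sum (map (Φ 11) ts) ∷ sumℤ (sq₇ 11) ts ∷ sumℤ sqₛ ts ∷ sumℤ sq₇ₛ ts ∷ [])
  weight-sum≡ [] = refl
  weight-sum≡ (t ∷ ts) rewrite weight-sum≡ ts = cong₂ _∷_ (sym (ℤP.pos-+ (Φ 11 t) (sum (map (Φ 11) ts)))) refl

  candidates×kept : ∀ ts → All Admissible ts → sum (map (Φ 11) ts) ℕ.≤ 96 → All (_∈ candidates) ts × Kept ts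
  candidates×kept [] [] _ = [] , tt
  candidates×kept (t ∷ ts) (admissible ∷ admissibles) ΣΦ≤96 =
    ∈-candidates t (admissible , ℕP.m+n≤o⇒m≤o (Φ 11 t) ΣΦ≤96) ∷ proj₁ rest , subst Keep (sym (weight-sum≡ (t ∷ ts))) ΣΦ≤96 , proj₂ rest
    where rest = candidates×kept ts admissibles (ℕP.m+n≤o⇒n≤o (Φ 11 t) ΣΦ≤96)

  no-sum-of-five : ∀ ts → length ts ≡ 5 → All Admissible ts →
    sumℤ (sq₁ 11) ts ≡ + 96 → sumℤ (sq₇ 11) ts ≡ + 10 → sumℤ sqₛ ts ≡ + 2 → sumℤ sq₇ₛ ts ≡ + 2 → ⊥
  no-sum-of-five ts length≡5 admissibles Σ₁≡ Σ₇≡ Σₛ≡ Σ₇ₛ≡ =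
    refutes-sound target≟ (reachable (length ts)) (subst (λ k → target-absent k ≡ true) (sym length≡5) target-absent-5)
      (weight-sum-reachable ts (proj₁ candidates×kept-ts) (proj₂ candidates×kept-ts)) (sym reached)
    where
    ΣΦ≡96 : sum (map (Φ 11) ts) ≡ 96
    ΣΦ≡96 = ℤP.+-injective (trans (sym (sumℤ-sq₁ 11 ts)) Σ₁≡)
    candidates×kept-ts = candidates×kept ts admissibles (ℕP.≤-reflexive ΣΦ≡96)
    reached : weight-sum ts ≡ target
    reached = trans (weight-sum≡ ts) (cong₂ _∷_ (cong +_ ΣΦ≡96) (cong₂ _∷_ Σ₇≡ (cong₂ _∷_ Σₛ≡ (cong₂ _∷_ Σ₇ₛ≡ refl))))

module Case-s≥15 where

  Candidate : Quadruple → Set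
  Candidate t = Admissible t × ν₂ t ℕ.≤ 6 × ν₁ t ℕ.≤ 62

  candidate? : Decidable Candidate
  candidate? t = admissible? t ×-dec (ν₂ t ℕ.≤? 6 ×-dec ν₁ t ℕ.≤? 62)

  candidates : List Quadruple
  candidates = filter candidate? (quadruples 7 2 2 0)

  ∈-candidates : ∀ t → Candidate t → t ∈ candidates
  ∈-candidates t@(A , B , C , D) candidate@(_ , ν₂≤6 , ν₁≤62) = ∈-filter⁺ candidate? (∈-quadruples A B C D
      (square-bound 1 ℤ.∣ A ∣ 62 7 (subst (ℕ._≤ 62) (sym (ℕP.*-identityˡ (ℤ.∣ A ∣ ℕ.* ℤ.∣ A ∣))) (ℕP.m+n≤o⇒m≤o _ ν₁≤62)) (from-yes (62 ℕ.<? 64)))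
      (square-bound 7 ℤ.∣ B ∣ 62 2 (ℕP.m+n≤o⇒n≤o (ℤ.∣ A ∣ ℕ.* ℤ.∣ A ∣) ν₁≤62) (from-yes (62 ℕ.<? 63)))
      (square-bound 1 ℤ.∣ C ∣ 6 2 (subst (ℕ._≤ 6) (sym (ℕP.*-identityˡ (ℤ.∣ C ∣ ℕ.* ℤ.∣ C ∣))) (ℕP.m+n≤o⇒m≤o _ ν₂≤6)) (from-yes (6 ℕ.<? 9)))
      (∣D∣≤0 t ν₂≤6))
    candidate
    where
    ∣D∣≤0 : ∀ t → ν₂ t ℕ.≤ 6 → ℤ.∣ proj₂ (proj₂ (proj₂ t)) ∣ ℕ.≤ 0
    ∣D∣≤0 (_ , _ , C , D) ν₂≤6 = square-bound 7 ℤ.∣ D ∣ 6 0 (ℕP.m+n≤o⇒n≤o (ℤ.∣ C ∣ ℕ.* ℤ.∣ C ∣) ν₂≤6) (from-yes (6 ℕ.<? 7))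

  D≡0 : ∀ t → ν₂ t ℕ.≤ 6 → proj₂ (proj₂ (proj₂ t)) ≡ + 0
  D≡0 (_ , _ , C , D) ν₂≤6 = ℤP.∣i∣≡0⇒i≡0 (ℕP.n≤0⇒n≡0 (square-bound 7 ℤ.∣ D ∣ 6 0 (ℕP.m+n≤o⇒n≤o (ℤ.∣ C ∣ ℕ.* ℤ.∣ C ∣) ν₂≤6) (from-yes (6 ℕ.<? 7))))

  AB : Quadruple → ℤ
  AB (A , B , _ , _) = A ℤ.* B

  -- With D = 0 throughout, the state records ν₂, ν₁ and the √7, √s, √7s coordinates of the sum.
  weight : Quadruple → Vec ℤ 5
  weight t = + ν₂ t ∷ + ν₁ t ∷ AB t ∷ sqₛ t ∷ sq₇ₛ t ∷ []

  Keep : Vec ℤ 5 → Set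
  Keep (u ∷ q ∷ _) = ℤ.∣ u ∣ ℕ.≤ 6 × ℤ.∣ q ∣ ℕ.≤ 62

  keep? : Decidable Keep
  keep? (u ∷ q ∷ _) = ℤ.∣ u ∣ ℕ.≤? 6 ×-dec ℤ.∣ q ∣ ℕ.≤? 62

  open Reachable weight keep? candidates

  -- The pairs (U, Q) with Q + s (U − 2) = 62 for some s ≥ 15.
  Feasible : ℕ → ℕ → Set
  Feasible U Q = (U ≡ 2 × Q ≡ 62) ⊎ (3 ℕ.≤ U × Q ℕ.+ 15 ℕ.* (U ∸ 2) ℕ.≤ 62)

  Bad : Vec ℤ 5 → Set
  Bad (u ∷ q ∷ p ∷ e ∷ f ∷ []) = Feasible ℤ.∣ u ∣ ℤ.∣ q ∣ × p ≡ + 6 × e ≡ + 2 × f ≡ + 2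

  bad? : Decidable Bad
  bad? (u ∷ q ∷ p ∷ e ∷ f ∷ []) =
    ((ℤ.∣ u ∣ ℕ.≟ 2 ×-dec ℤ.∣ q ∣ ℕ.≟ 62) ⊎-dec (3 ℕ.≤? ℤ.∣ u ∣ ×-dec ℤ.∣ q ∣ ℕ.+ 15 ℕ.* (ℤ.∣ u ∣ ∸ 2) ℕ.≤? 62))
    ×-dec p ℤP.≟ + 6 ×-dec e ℤP.≟ + 2 ×-dec f ℤP.≟ + 2

  bad-absent : ℕ → Bool
  bad-absent k = refutes bad? (reachable k)

  bad-absent-5 : bad-absent 5 ≡ true
  bad-absent-5 = refl

  weight-sum≡ : ∀ ts → weight-sum ts ≡ (+ sum (map ν₂ ts) ∷ + sum (map ν₁ ts) ∷ sumℤ AB ts ∷ sumℤ sqₛ ts ∷ sumℤ sq₇ₛ ts ∷ [])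
  weight-sum≡ [] = refl
  weight-sum≡ (t ∷ ts) rewrite weight-sum≡ ts =
    cong₂ _∷_ (sym (ℤP.pos-+ (ν₂ t) (sum (map ν₂ ts)))) (cong₂ _∷_ (sym (ℤP.pos-+ (ν₁ t) (sum (map ν₁ ts)))) refl)

  candidates×kept : ∀ ts → All Admissible ts → sum (map ν₂ ts) ℕ.≤ 6 → sum (map ν₁ ts) ℕ.≤ 62 → All (_∈ candidates) ts × Kept ts
  candidates×kept [] [] _ _ = [] , tt
  candidates×kept (t ∷ ts) (admissible ∷ admissibles) ΣU≤6 ΣQ≤62 =
    ∈-candidates t (admissible , ℕP.m+n≤o⇒m≤o (ν₂ t) ΣU≤6 , ℕP.m+n≤o⇒m≤o (ν₁ t) ΣQ≤62) ∷ proj₁ rest ,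
    subst Keep (sym (weight-sum≡ (t ∷ ts))) (ΣU≤6 , ΣQ≤62) , proj₂ rest
    where rest = candidates×kept ts admissibles (ℕP.m+n≤o⇒n≤o (ν₂ t) ΣU≤6) (ℕP.m+n≤o⇒n≤o (ν₁ t) ΣQ≤62)

  sumℤ-sq₇≡AB : ∀ s ts → sum (map ν₂ ts) ℕ.≤ 6 → sumℤ (sq₇ s) ts ≡ sumℤ AB ts
  sumℤ-sq₇≡AB s [] _ = refl
  sumℤ-sq₇≡AB s (t@(A , B , C , D) ∷ ts) ΣU≤6 = cong₂ ℤ._+_ sq₇≡AB (sumℤ-sq₇≡AB s ts (ℕP.m+n≤o⇒n≤o (ν₂ t) ΣU≤6))
    where
    sq₇≡AB : A ℤ.* B ℤ.+ + s ℤ.* (C ℤ.* D) ≡ A ℤ.* B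
    sq₇≡AB rewrite D≡0 t (ℕP.m+n≤o⇒m≤o (ν₂ t) ΣU≤6) =
      trans (cong (λ x → A ℤ.* B ℤ.+ + s ℤ.* x) (ℤP.*-zeroʳ C)) (trans (cong (ℤ._+_ (A ℤ.* B)) (ℤP.*-zeroʳ (+ s))) (ℤP.+-identityʳ (A ℤ.* B)))

  n*n≡0⇒n≡0 : ∀ n → n ℕ.* n ≡ 0 → n ≡ 0
  n*n≡0⇒n≡0 zero _ = refl

  sqₛ-sum-vanishes : ∀ ts → sum (map ν₂ ts) ≡ 0 → sumℤ sqₛ ts ≡ + 0
  sqₛ-sum-vanishes [] _ = refl
  sqₛ-sum-vanishes (t@(A , B , C , D) ∷ ts) ΣU≡0 = cong₂ ℤ._+_ sqₛ≡0 (sqₛ-sum-vanishes ts (ℕP.m+n≡0⇒n≡0 (ν₂ t) ΣU≡0))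
    where
    ν₂≡0 : ν₂ t ≡ 0
    ν₂≡0 = ℕP.m+n≡0⇒m≡0 (ν₂ t) ΣU≡0
    C≡0 : C ≡ + 0
    C≡0 = ℤP.∣i∣≡0⇒i≡0 (n*n≡0⇒n≡0 ℤ.∣ C ∣ (ℕP.m+n≡0⇒m≡0 (ℤ.∣ C ∣ ℕ.* ℤ.∣ C ∣) ν₂≡0))
    D≡0′ : D ≡ + 0
    D≡0′ = ℤP.∣i∣≡0⇒i≡0 (n*n≡0⇒n≡0 ℤ.∣ D ∣ (ℕP.*-cancelˡ-≡ _ 0 7 (trans (ℕP.m+n≡0⇒n≡0 (ℤ.∣ C ∣ ℕ.* ℤ.∣ C ∣) ν₂≡0) (sym (ℕP.*-zeroʳ 7)))))
    sqₛ≡0 : A ℤ.* C ℤ.+ + 7 ℤ.* (B ℤ.* D) ≡ + 0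
    sqₛ≡0 rewrite C≡0 | D≡0′ = cong₂ ℤ._+_ (ℤP.*-zeroʳ A) (cong (+ 7 ℤ.*_) (ℤP.*-zeroʳ B))

  -- C² + 7D² − (AD + BC) = C (B + C) − 2BC + 8D² − D (A + D).
  2∣ν₂-sq₇ₛ : ∀ t → Admissible t → + 2 ℤD.∣ + ν₂ t ℤ.- sq₇ₛ t
  2∣ν₂-sq₇ₛ t@(A , B , C , D) (divides α A+D≡α2 , divides β B+C≡β2) = divides (C ℤ.* β ℤ.- B ℤ.* C ℤ.+ + 4 ℤ.* (D ℤ.* D) ℤ.- D ℤ.* α) (begin
    + ν₂ t ℤ.- (A ℤ.* D ℤ.+ B ℤ.* C)                       ≡⟨ cong (ℤ._- (A ℤ.* D ℤ.+ B ℤ.* C)) (squares-≡ C D) ⟨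
    (C ℤ.* C ℤ.+ + 7 ℤ.* (D ℤ.* D)) ℤ.- (A ℤ.* D ℤ.+ B ℤ.* C)
      ≡⟨ ℤS.solve 4 (λ A B C D → (C ℤS.:* C ℤS.:+ ℤS.con (+ 7) ℤS.:* (D ℤS.:* D)) ℤS.:- (A ℤS.:* D ℤS.:+ B ℤS.:* C) ℤS.:=
           C ℤS.:* (B ℤS.:+ C) ℤS.:- ℤS.con (+ 2) ℤS.:* (B ℤS.:* C) ℤS.:+ ℤS.con (+ 8) ℤS.:* (D ℤS.:* D) ℤS.:- D ℤS.:* (A ℤS.:+ D)) refl A B C D ⟩
    C ℤ.* (B ℤ.+ C) ℤ.- + 2 ℤ.* (B ℤ.* C) ℤ.+ + 8 ℤ.* (D ℤ.* D) ℤ.- D ℤ.* (A ℤ.+ D)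
      ≡⟨ cong₂ (λ x y → C ℤ.* x ℤ.- + 2 ℤ.* (B ℤ.* C) ℤ.+ + 8 ℤ.* (D ℤ.* D) ℤ.- D ℤ.* y) B+C≡β2 A+D≡α2 ⟩
    C ℤ.* (β ℤ.* + 2) ℤ.- + 2 ℤ.* (B ℤ.* C) ℤ.+ + 8 ℤ.* (D ℤ.* D) ℤ.- D ℤ.* (α ℤ.* + 2)
      ≡⟨ ℤS.solve 5 (λ B C D α β → C ℤS.:* (β ℤS.:* ℤS.con (+ 2)) ℤS.:- ℤS.con (+ 2) ℤS.:* (B ℤS.:* C) ℤS.:+ ℤS.con (+ 8) ℤS.:* (D ℤS.:* D) ℤS.:- D ℤS.:* (α ℤS.:* ℤS.con (+ 2)) ℤS.:=
           (C ℤS.:* β ℤS.:- B ℤS.:* C ℤS.:+ ℤS.con (+ 4) ℤS.:* (D ℤS.:* D) ℤS.:- D ℤS.:* α) ℤS.:* ℤS.con (+ 2)) refl B C D α β ⟩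
    (C ℤ.* β ℤ.- B ℤ.* C ℤ.+ + 4 ℤ.* (D ℤ.* D) ℤ.- D ℤ.* α) ℤ.* + 2 ∎)
    where open ≡-Reasoning

  2∣ΣU-Σsq₇ₛ : ∀ ts → All Admissible ts → + 2 ℤD.∣ + sum (map ν₂ ts) ℤ.- sumℤ sq₇ₛ ts
  2∣ΣU-Σsq₇ₛ [] [] = divides (+ 0) refl
  2∣ΣU-Σsq₇ₛ (t ∷ ts) (admissible ∷ admissibles) =
    subst (+ 2 ℤD.∣_) (sym split) (ℤD.∣m∣n⇒∣m+n (2∣ν₂-sq₇ₛ t admissible) (2∣ΣU-Σsq₇ₛ ts admissibles))
    where
    split : + (ν₂ t ℕ.+ sum (map ν₂ ts)) ℤ.- (sq₇ₛ t ℤ.+ sumℤ sq₇ₛ ts) ≡ (+ ν₂ t ℤ.- sq₇ₛ t) ℤ.+ (+ sum (map ν₂ ts) ℤ.- sumℤ sq₇ₛ ts)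
    split = trans (cong (ℤ._- (sq₇ₛ t ℤ.+ sumℤ sq₇ₛ ts)) (ℤP.pos-+ (ν₂ t) _))
      (ℤS.solve 4 (λ a b c d → (a ℤS.:+ b) ℤS.:- (c ℤS.:+ d) ℤS.:= (a ℤS.:- c) ℤS.:+ (b ℤS.:- d)) refl (+ ν₂ t) (+ sum (map ν₂ ts)) (sq₇ₛ t) (sumℤ sq₇ₛ ts))

  U-Q-range : ∀ s U Q → 15 ℕ.≤ s → U ≢ 0 → U ≢ 1 → Q ℕ.+ s ℕ.* U ≡ 62 ℕ.+ 2 ℕ.* s → U ℕ.≤ 6 × Q ℕ.≤ 62 × Feasible U Q
  U-Q-range s 0 Q _ U≢0 _ _ = ⊥-elim (U≢0 refl)
  U-Q-range s 1 Q _ _ U≢1 _ = ⊥-elim (U≢1 refl)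
  U-Q-range s (suc (suc V)) Q 15≤s _ _ Q+sU≡ = s≤s (s≤s V≤4) , Q≤62 , feasible V refl
    where
    Q+sV≡62 : Q ℕ.+ s ℕ.* V ≡ 62
    Q+sV≡62 = ℕP.+-cancelʳ-≡ (2 ℕ.* s) (Q ℕ.+ s ℕ.* V) 62
      (trans (ℕS.solve 3 (λ Q s V → Q ℕS.:+ s ℕS.:* V ℕS.:+ ℕS.con 2 ℕS.:* s ℕS.:= Q ℕS.:+ s ℕS.:* (ℕS.con 2 ℕS.:+ V)) refl Q s V) Q+sU≡)
    Q≤62 : Q ℕ.≤ 62
    Q≤62 = subst (Q ℕ.≤_) Q+sV≡62 (ℕP.m≤m+n Q (s ℕ.* V))
    V≤4 : V ℕ.≤ 4
    V≤4 with V ℕ.≤? 4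
    ... | yes V≤4 = V≤4
    ... | no V≰4 = ⊥-elim (ℕP.<⇒≱ (from-yes (62 ℕ.<? 75))
            (ℕP.≤-trans (ℕP.*-mono-≤ 15≤s (ℕP.≰⇒> V≰4)) (subst (s ℕ.* V ℕ.≤_) Q+sV≡62 (ℕP.m≤n+m (s ℕ.* V) Q))))
    feasible : ∀ W → W ≡ V → Feasible (suc (suc V)) Q
    feasible zero refl = inj₁ (refl , trans (sym (trans (cong (Q ℕ.+_) (ℕP.*-zeroʳ s)) (ℕP.+-identityʳ Q))) Q+sV≡62)
    feasible (suc W) refl = inj₂ (s≤s (s≤s (s≤s z≤n)) , subst (Q ℕ.+ 15 ℕ.* suc W ℕ.≤_) Q+sV≡62 (ℕP.+-monoʳ-≤ Q (ℕP.*-monoˡ-≤ (suc W) 15≤s)))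

  no-sum-of-five : ∀ s → 15 ℕ.≤ s → ∀ ts → length ts ≡ 5 → All Admissible ts →
    sumℤ (sq₁ s) ts ≡ + (62 ℕ.+ 2 ℕ.* s) → sumℤ (sq₇ s) ts ≡ + 6 → sumℤ sqₛ ts ≡ + 2 → sumℤ sq₇ₛ ts ≡ + 2 → ⊥
  no-sum-of-five s 15≤s ts length≡5 admissibles Σ₁≡ Σ₇≡ Σₛ≡ Σ₇ₛ≡ =
    refutes-sound bad? (reachable (length ts)) (subst (λ k → bad-absent k ≡ true) (sym length≡5) bad-absent-5)
      (weight-sum-reachable ts (proj₁ candidates×kept-ts) (proj₂ candidates×kept-ts))
      (subst Bad (sym (weight-sum≡ ts)) (feasible , trans (sym (sumℤ-sq₇≡AB s ts U≤6)) Σ₇≡ , Σₛ≡ , Σ₇ₛ≡))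
    where
    U = sum (map ν₂ ts)
    Q = sum (map ν₁ ts)
    Q+sU≡ : Q ℕ.+ s ℕ.* U ≡ 62 ℕ.+ 2 ℕ.* s
    Q+sU≡ = ℤP.+-injective (trans (sym (trans (sumℤ-sq₁ s ts) (cong +_ (sum-Φ s ts)))) Σ₁≡)
    U≢0 : U ≢ 0
    U≢0 U≡0 with () ← trans (sym (sqₛ-sum-vanishes ts U≡0)) Σₛ≡
    U≢1 : U ≢ 1
    U≢1 U≡1 with ℕD.∣⇒≤ (∣⇒∣ᵤ (subst (+ 2 ℤD.∣_) (cong₂ ℤ._-_ (cong +_ U≡1) Σ₇ₛ≡) (2∣ΣU-Σsq₇ₛ ts admissibles)))
    ... | s≤s ()
    bounds : U ℕ.≤ 6 × Q ℕ.≤ 62 × Feasible U Q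
    bounds = U-Q-range s U Q 15≤s U≢0 U≢1 Q+sU≡
    U≤6 : U ℕ.≤ 6
    U≤6 = proj₁ bounds
    feasible : Feasible U Q
    feasible = proj₂ (proj₂ bounds)
    candidates×kept-ts : All (_∈ candidates) ts × Kept ts
    candidates×kept-ts = candidates×kept ts admissibles U≤6 (proj₁ (proj₂ bounds))

√7ₑ ωₑ : KExpr
√7ₑ = ⟪ con 0ℚ , con 1ℚ , con 0ℚ , con 0ℚ ⟫
ωₑ = ⟪ con 0ℚ , con ½ , con ½ , con 0ℚ ⟫

quarticₑ : KExpr → Polynomial 18 → Polynomial 18 → Polynomial 18 → Polynomial 18 → KExpr
quarticₑ x c₀ c₁ c₂ c₃ = ratₑ c₀ ⊕ₑ x ⊗ₑ (ratₑ c₁ ⊕ₑ x ⊗ₑ (ratₑ c₂ ⊕ₑ x ⊗ₑ (ratₑ c₃ ⊕ₑ x ⊗ₑ 𝟙ₑ)))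

module _ {s : ℕ} where

  private
    ρ = env {s} 𝟘 𝟘 𝟘 𝟘

  quartic : K s → ℚ → ℚ → ℚ → ℚ → K s
  quartic x c₀ c₁ c₂ c₃ = rat c₀ ⊕ x ⊗ (rat c₁ ⊕ x ⊗ (rat c₂ ⊕ x ⊗ (rat c₃ ⊕ x ⊗ 𝟙)))

  𝟙-IsAlgInt : IsAlgInt (𝟙 {s})
  𝟙-IsAlgInt = -[1+ 0 ] ∷ [] , K-solve ρ (ratₑ (con (fromℤ -[1+ 0 ])) ⊕ₑ 𝟙ₑ ⊗ₑ 𝟙ₑ) (ratₑ (con 0ℚ)) refl refl refl refl

  𝟘-IsAlgInt : IsAlgInt (𝟘 {s})
  𝟘-IsAlgInt = + 0 ∷ [] , K-solve ρ (ratₑ (con 0ℚ) ⊕ₑ ratₑ (con 0ℚ) ⊗ₑ 𝟙ₑ) (ratₑ (con 0ℚ)) refl refl refl refl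

  -- x² − 2x − 6, with −6 written as −(7 − 1) since 7 is symbolic.
  1+√7-IsAlgInt : IsAlgInt (𝟙 {s} ⊕ √7)
  1+√7-IsAlgInt = -[1+ 5 ] ∷ -[1+ 1 ] ∷ [] ,
    K-solve ρ (ratₑ (:- (var (# 1) :- con 1ℚ)) ⊕ₑ (𝟙ₑ ⊕ₑ √7ₑ) ⊗ₑ (ratₑ (con (fromℤ -[1+ 1 ])) ⊕ₑ (𝟙ₑ ⊕ₑ √7ₑ) ⊗ₑ 𝟙ₑ)) (ratₑ (con 0ℚ)) refl refl refl refl

-- For s = 3 + 4k, ω = (√7 + √s)/2 is a root of x⁴ − (2k + 5) x² + (k − 1)², i.e. of
-- x⁴ − m x² + n with m = (7 + s)/2 and n = ((s − 7)/4)², and 1 + ω of the shifted polynomial.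
module _ {s : ℕ} (k : ℕ) (s≡3+k*4 : s ≡ 3 ℕ.+ k ℕ.* 4) where

  private
    ρ = env {s} 𝟘 𝟘 𝟘 𝟘
    S seven κ : ℚ
    S = fromℤ (+ s)
    seven = fromℤ (+ 7)
    κ = fromℤ (+ k)
    mₑ nₑ : Polynomial 18
    mₑ = (var (# 1) :+ var (# 0)) :* con ½
    nₑ = ((var (# 0) :- var (# 1)) :* con ¼) :* ((var (# 0) :- var (# 1)) :* con ¼)

    S≡ : S ≡ fromℤ (+ 3) ℚ.+ κ ℚ.* fromℤ (+ 4)
    S≡ = trans (cong (λ n → fromℤ (+ n)) s≡3+k*4) (trans (cong fromℤ (trans (ℤP.pos-+ 3 (k ℕ.* 4)) (cong (ℤ._+_ (+ 3)) (ℤP.pos-* k 4))))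
           (trans (fromℤ-+ (+ 3) (+ k ℤ.* + 4)) (cong (fromℤ (+ 3) ℚ.+_) (fromℤ-* (+ k) (+ 4)))))

    -- An integer polynomial in k equals a rational function of S, as checked after substituting S = 3 + 4k.
    coefficient : ∀ (c : IntExpr 1) (f : ℚ → ℚ) → ⟦ c ⟧ℚ (κ ∷ []) ≡ f (fromℤ (+ 3) ℚ.+ κ ℚ.* fromℤ (+ 4)) →
      fromℤ (⟦ c ⟧ℤ (+ k ∷ [])) ≡ f S
    coefficient c f eq = trans (fromℤ-⟦⟧ c (+ k ∷ [])) (trans eq (cong f (sym S≡)))

    k-1 : IntExpr 1
    k-1 = evar (# 0) ⊞ ⊟ econ (+ 1)

  ω-IsAlgInt : IsAlgInt (ω {s})
  ω-IsAlgInt = ⟦ k-1 ⊠ k-1 ⟧ℤ (+ k ∷ []) ∷ + 0 ∷ ⟦ ⊟ (econ (+ 2) ⊠ evar (# 0) ⊞ econ (+ 5)) ⟧ℤ (+ k ∷ []) ∷ + 0 ∷ [] ,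
    trans (cong₂ (λ c₀ c₂ → quartic ω c₀ 0ℚ c₂ 0ℚ)
      (coefficient (k-1 ⊠ k-1) (λ S → ((S ℚ.- seven) ℚ.* ¼) ℚ.* ((S ℚ.- seven) ℚ.* ¼))
        (ℚS.solve 1 (λ κ → (κ ℚS.:- ℚS.con 1ℚ) ℚS.:* (κ ℚS.:- ℚS.con 1ℚ) ℚS.:=
          (((ℚS.con (fromℤ (+ 3)) ℚS.:+ κ ℚS.:* ℚS.con (fromℤ (+ 4))) ℚS.:- ℚS.con seven) ℚS.:* ℚS.con ¼) ℚS.:* (((ℚS.con (fromℤ (+ 3)) ℚS.:+ κ ℚS.:* ℚS.con (fromℤ (+ 4))) ℚS.:- ℚS.con seven) ℚS.:* ℚS.con ¼)) refl κ))
      (coefficient (⊟ (econ (+ 2) ⊠ evar (# 0) ⊞ econ (+ 5))) (λ S → ℚ.- ((seven ℚ.+ S) ℚ.* ½))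
        (ℚS.solve 1 (λ κ → ℚS.:- (ℚS.con (fromℤ (+ 2)) ℚS.:* κ ℚS.:+ ℚS.con (fromℤ (+ 5))) ℚS.:=
          ℚS.:- ((ℚS.con seven ℚS.:+ (ℚS.con (fromℤ (+ 3)) ℚS.:+ κ ℚS.:* ℚS.con (fromℤ (+ 4)))) ℚS.:* ℚS.con ½)) refl κ)))
    (K-solve ρ (quarticₑ ωₑ nₑ (con 0ℚ) (:- mₑ) (con 0ℚ)) (ratₑ (con 0ℚ)) refl refl refl refl)

  1+ω-IsAlgInt : IsAlgInt (𝟙 {s} ⊕ ω)
  1+ω-IsAlgInt = ⟦ c₀ ⟧ℤ (+ k ∷ []) ∷ ⟦ c₁ ⟧ℤ (+ k ∷ []) ∷ ⟦ c₂ ⟧ℤ (+ k ∷ []) ∷ -[1+ 3 ] ∷ [] ,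
    trans (cong₂ (λ c₀ c₁₂ → quartic (𝟙 ⊕ ω) c₀ (proj₁ c₁₂) (proj₂ c₁₂) (fromℤ -[1+ 3 ]))
      (coefficient c₀ (λ S → 1ℚ ℚ.- (seven ℚ.+ S) ℚ.* ½ ℚ.+ ((S ℚ.- seven) ℚ.* ¼) ℚ.* ((S ℚ.- seven) ℚ.* ¼))
        (ℚS.solve 1 (λ κ → κ ℚS.:* κ ℚS.:- ℚS.con (fromℤ (+ 4)) ℚS.:* κ ℚS.:- ℚS.con (fromℤ (+ 3)) ℚS.:=
          ℚS.con 1ℚ ℚS.:- (ℚS.con seven ℚS.:+ (ℚS.con (fromℤ (+ 3)) ℚS.:+ κ ℚS.:* ℚS.con (fromℤ (+ 4)))) ℚS.:* ℚS.con ½ ℚS.:+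
          (((ℚS.con (fromℤ (+ 3)) ℚS.:+ κ ℚS.:* ℚS.con (fromℤ (+ 4))) ℚS.:- ℚS.con seven) ℚS.:* ℚS.con ¼) ℚS.:* (((ℚS.con (fromℤ (+ 3)) ℚS.:+ κ ℚS.:* ℚS.con (fromℤ (+ 4))) ℚS.:- ℚS.con seven) ℚS.:* ℚS.con ¼)) refl κ))
      (cong₂ _,_
        (coefficient c₁ (λ S → fromℤ (+ 2) ℚ.* ((seven ℚ.+ S) ℚ.* ½) ℚ.- fromℤ (+ 4))
          (ℚS.solve 1 (λ κ → ℚS.con (fromℤ (+ 4)) ℚS.:* κ ℚS.:+ ℚS.con (fromℤ (+ 6)) ℚS.:=
            ℚS.con (fromℤ (+ 2)) ℚS.:* ((ℚS.con seven ℚS.:+ (ℚS.con (fromℤ (+ 3)) ℚS.:+ κ ℚS.:* ℚS.con (fromℤ (+ 4)))) ℚS.:* ℚS.con ½) ℚS.:- ℚS.con (fromℤ (+ 4))) refl κ))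
        (coefficient c₂ (λ S → fromℤ (+ 6) ℚ.- (seven ℚ.+ S) ℚ.* ½)
          (ℚS.solve 1 (λ κ → ℚS.con 1ℚ ℚS.:- ℚS.con (fromℤ (+ 2)) ℚS.:* κ ℚS.:=
            ℚS.con (fromℤ (+ 6)) ℚS.:- (ℚS.con seven ℚS.:+ (ℚS.con (fromℤ (+ 3)) ℚS.:+ κ ℚS.:* ℚS.con (fromℤ (+ 4)))) ℚS.:* ℚS.con ½) refl κ))))
    (K-solve ρ (quarticₑ (𝟙ₑ ⊕ₑ ωₑ) (con 1ℚ :- mₑ :+ nₑ) (con (fromℤ (+ 2)) :* mₑ :- con (fromℤ (+ 4))) (con (fromℤ (+ 6)) :- mₑ) (con (fromℤ -[1+ 3 ])))
      (ratₑ (con 0ℚ)) refl refl refl refl)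
    where
    c₀ c₁ c₂ : IntExpr 1
    c₀ = evar (# 0) ⊠ evar (# 0) ⊞ ⊟ (econ (+ 4) ⊠ evar (# 0)) ⊞ ⊟ econ (+ 3)
    c₁ = econ (+ 4) ⊠ evar (# 0) ⊞ econ (+ 6)
    c₂ = econ (+ 1) ⊞ ⊟ (econ (+ 2) ⊠ evar (# 0))

module _ {s : ℕ} where

  sumSq-++-𝟘s : ∀ (xs : List (K s)) n → sumSq (xs ++ replicate n 𝟘) ≡ sumSq xs
  sumSq-++-𝟘s [] zero = refl
  sumSq-++-𝟘s [] (suc n) = trans (cong (𝟘 ⊗ 𝟘 ⊕_) (sumSq-++-𝟘s [] n)) (trans (cong (_⊕ 𝟘) (⊗-zeroˡ 𝟘)) (⊕-identityˡ 𝟘))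
  sumSq-++-𝟘s (x ∷ xs) n = cong (x ⊗ x ⊕_) (sumSq-++-𝟘s xs n)

  -- Lets the finite search run for exactly five squares.
  SumOfSquares-pad : ∀ {m α} → m ≤ 5 → SumOfSquares m α → SumOfSquares 5 α
  SumOfSquares-pad {m} m≤5 (xs , length≡m , integral , sumSq≡α) =
    xs ++ replicate (5 ∸ m) 𝟘 ,
    trans (ListP.length-++ xs) (trans (cong₂ ℕ._+_ length≡m (ListP.length-replicate (5 ∸ m))) (ℕP.m+[n∸m]≡n m≤5)) ,
    AllP.++⁺ integral (AllP.replicate⁺ (5 ∸ m) 𝟘-IsAlgInt) ,
    trans (sumSq-++-𝟘s xs (5 ∸ m)) sumSq≡α

  no-fewer-than-six : s % 4 ≡ 3 → SquareFree s → ¬ 7 ∣ s → ∀ {α} a b c d → α ≡ quarters a b c d →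
    (∀ ts → length ts ≡ 5 → All Admissible ts →
      sumℤ (sq₁ s) ts ≡ a → sumℤ (sq₇ s) ts ≡ b → sumℤ sqₛ ts ≡ c → sumℤ sq₇ₛ ts ≡ d → ⊥) →
    ∀ m → m < 6 → ¬ SumOfSquares m α
  no-fewer-than-six s%4≡3 sf 7∤s {α} a b c d α≡ no-five m m<6 sos = no-five-squares (SumOfSquares-pad (ℕP.≤-pred m<6) sos)
    where
    no-five-squares : SumOfSquares 5 α → ⊥
    no-five-squares (xs , length≡5 , integral , sumSq≡α) = no-quadruples (sumSq-quarters s%4≡3 sf 7∤s xs integral)
      where
      no-quadruples : (Σ (List Quadruple) λ ts → length ts ≡ length xs × All Admissible ts × sumSq xs ≡ sum-of-quarters ts) → ⊥
      no-quadruples (ts , length≡ , admissible , sumSq≡) =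
        no-five ts (trans length≡ length≡5) admissible (proj₁ sums) (proj₁ (proj₂ sums)) (proj₁ (proj₂ (proj₂ sums))) (proj₂ (proj₂ (proj₂ sums)))
        where
        sums : sumℤ (sq₁ s) ts ≡ a × sumℤ (sq₇ s) ts ≡ b × sumℤ sqₛ ts ≡ c × sumℤ sq₇ₛ ts ≡ d
        sums = quarters-injective (trans (sym sumSq≡) (trans sumSq≡α α≡))

α≥15-quarters : ∀ s → α≥15 s ≡ quarters (+ (62 ℕ.+ 2 ℕ.* s)) (+ 6) (+ 2) (+ 2)
α≥15-quarters s = trans
  (K-solve (env {s} 𝟘 𝟘 𝟘 𝟘) α≥15ₑ ⟪ (con (fromℤ (+ 62)) :+ con (fromℤ (+ 2)) :* var (# 0)) :* con ¼ , con (fromℤ (+ 6)) :* con ½ , con (fromℤ (+ 2)) :* con ½ , con (fromℤ (+ 2)) :* con ½ ⟫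
    refl refl refl refl)
  (⟨⟩-cong (cong (ℚ._* ¼) (sym 62+2s)) refl refl refl)
  where
  α≥15ₑ : KExpr
  α≥15ₑ = 𝟙ₑ ⊗ₑ 𝟙ₑ ⊕ₑ 𝟙ₑ ⊗ₑ 𝟙ₑ ⊕ₑ 𝟙ₑ ⊗ₑ 𝟙ₑ ⊕ₑ (𝟙ₑ ⊕ₑ √7ₑ) ⊗ₑ (𝟙ₑ ⊕ₑ √7ₑ) ⊕ₑ ωₑ ⊗ₑ ωₑ ⊕ₑ (𝟙ₑ ⊕ₑ ωₑ) ⊗ₑ (𝟙ₑ ⊕ₑ ωₑ)
  62+2s : fromℤ (+ (62 ℕ.+ 2 ℕ.* s)) ≡ fromℤ (+ 62) ℚ.+ fromℤ (+ 2) ℚ.* fromℤ (+ s)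
  62+2s = trans (cong fromℤ (trans (ℤP.pos-+ 62 (2 ℕ.* s)) (cong (ℤ._+_ (+ 62)) (ℤP.pos-* 2 s))))
    (trans (fromℤ-+ (+ 62) (+ 2 ℤ.* + s)) (cong (fromℤ (+ 62) ℚ.+_) (fromℤ-* (+ 2) (+ s))))

α11-quarters : α11 ≡ quarters (+ 96) (+ 10) (+ 2) (+ 2)
α11-quarters = refl

α≥15-sum-of-six : ∀ {s} k → s ≡ 3 ℕ.+ k ℕ.* 4 → SumOfSquares {s} 6 (α≥15 s)
α≥15-sum-of-six {s} k s≡ = 𝟙 ∷ 𝟙 ∷ 𝟙 ∷ (𝟙 ⊕ √7) ∷ ω ∷ (𝟙 ⊕ ω) ∷ [] , refl ,
  𝟙-IsAlgInt ∷ 𝟙-IsAlgInt ∷ 𝟙-IsAlgInt ∷ 1+√7-IsAlgInt ∷ ω-IsAlgInt k s≡ ∷ 1+ω-IsAlgInt k s≡ ∷ [] ,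
  K-solve (env {s} 𝟘 𝟘 𝟘 𝟘)
    (𝟙ₑ ⊗ₑ 𝟙ₑ ⊕ₑ (𝟙ₑ ⊗ₑ 𝟙ₑ ⊕ₑ (𝟙ₑ ⊗ₑ 𝟙ₑ ⊕ₑ ((𝟙ₑ ⊕ₑ √7ₑ) ⊗ₑ (𝟙ₑ ⊕ₑ √7ₑ) ⊕ₑ (ωₑ ⊗ₑ ωₑ ⊕ₑ ((𝟙ₑ ⊕ₑ ωₑ) ⊗ₑ (𝟙ₑ ⊕ₑ ωₑ) ⊕ₑ ratₑ (con 0ℚ)))))))
    (𝟙ₑ ⊗ₑ 𝟙ₑ ⊕ₑ 𝟙ₑ ⊗ₑ 𝟙ₑ ⊕ₑ 𝟙ₑ ⊗ₑ 𝟙ₑ ⊕ₑ (𝟙ₑ ⊕ₑ √7ₑ) ⊗ₑ (𝟙ₑ ⊕ₑ √7ₑ) ⊕ₑ ωₑ ⊗ₑ ωₑ ⊕ₑ (𝟙ₑ ⊕ₑ ωₑ) ⊗ₑ (𝟙ₑ ⊕ₑ ωₑ))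
    refl refl refl refl

α11-sum-of-six : SumOfSquares {11} 6 α11
α11-sum-of-six = 𝟙 ∷ 𝟙 ∷ 𝟙 ∷ (ι (+ 2) ⊕ √7) ∷ ω ∷ (𝟙 ⊕ ω) ∷ [] , refl ,
  𝟙-IsAlgInt ∷ 𝟙-IsAlgInt ∷ 𝟙-IsAlgInt ∷ (-[1+ 2 ] ∷ -[1+ 3 ] ∷ [] , refl) ∷ ω-IsAlgInt 2 refl ∷ 1+ω-IsAlgInt 2 refl ∷ [] , refl

7<s<15⇒s≡11 : ∀ s → 7 < s → s < 15 → s % 4 ≡ 3 → s ≡ 11
7<s<15⇒s≡11 s 7<s s<15 = subst (λ n → 7 < n → n % 4 ≡ 3 → n ≡ 11) (FinP.toℕ-fromℕ< s<15) (by-cases (fromℕ< s<15)) 7<s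
  where
  by-cases : ∀ (i : Fin 15) → 7 < toℕ i → toℕ i % 4 ≡ 3 → toℕ i ≡ 11
  by-cases = from-yes (FinP.all? {n = 15} λ i → 7 ℕ.<? toℕ i →-dec toℕ i % 4 ℕ.≟ 3 →-dec toℕ i ℕ.≟ 11)

proposition3p5 : (s : ℕ) → 7 < s → SquareFree s → ¬ (7 ∣ s) → s % 4 ≡ 3 →
    PythagorasAtLeast {s} 6
    × (15 ≤ s → HasLength (α≥15 s) 6)
    × ((p : s ≡ 11) → HasLength α11 6)
proposition3p5 s 7<s sf 7∤s s%4≡3 = pythagoras , length-α≥15 , length-α11
  where
  length-α≥15 : 15 ≤ s → HasLength (α≥15 s) 6
  length-α≥15 15≤s = α≥15-sum-of-six (s ℕ./ 4) (trans (m≡m%n+[m/n]*n s 4) (cong (ℕ._+ s ℕ./ 4 ℕ.* 4) s%4≡3)) ,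
    no-fewer-than-six s%4≡3 sf 7∤s (+ (62 ℕ.+ 2 ℕ.* s)) (+ 6) (+ 2) (+ 2) (α≥15-quarters s) (Case-s≥15.no-sum-of-five s 15≤s)
  length-α11 : (p : s ≡ 11) → HasLength α11 6
  length-α11 refl = α11-sum-of-six , no-fewer-than-six s%4≡3 sf 7∤s (+ 96) (+ 10) (+ 2) (+ 2) α11-quarters Case-s≡11.no-sum-of-five
  pythagoras : PythagorasAtLeast {s} 6
  pythagoras with 15 ℕ.≤? s
  ... | yes 15≤s = α≥15 s , 6 , length-α≥15 15≤s
  ... | no 15≰s = subst (λ n → PythagorasAtLeast {n} 6) (sym s≡11) (α11 , 6 , length-α11 s≡11)
    where
    s≡11 : s ≡ 11
    s≡11 = 7<s<15⇒s≡11 s 7<s (ℕP.≰⇒> 15≰s) s%4≡3
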